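{- Fix $q\in\{2,3,5,6\}$. Then the group $\mathcal{P}_q$ is generated by the set of all classes $[a,b,p]$ of triples $(a,b,p)\in T_q$ with $a>0$ and $p$ a prime number such that there exist $u,v\in\mathbb{Z}$ with $p=u^2+qv^2$ or $2p=u^2+qv^2$.
   Context: For a fixed square-free positive integer $q$, let $T_q$ be the set of integer triples $(a,b,c)\in\mathbb{Z}\times\mathbb{Z}\times\mathbb{N}$ ($\mathbb{N}$ the positive integers) with $a^2+qb^2=c^2$. Two triples $(a,b,c),(A,B,C)\in T_q$ are equivalent if there exist nonzero integers $m,n$ with $(ma,mb,|mc|)=(nA,nB,|nC|)$; the class of $(a,b,c)$ is denoted $[a,b,c]$, and $\mathcal{P}_q$ is the set of classes. $\mathcal{P}_q$ is an abelian group under $[a,b,c]+[A,B,C]:=[aA-qbB,\ aB+bA,\ cC]$, with identity $[1,0,1]$ and inverse $-[a,b,c]=[a,-b,c]=[-a,b,c]$. -}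

module Defs where

open import Data.Nat as ℕ using (ℕ)
open import Data.Nat.Primality using (Prime)
open import Data.Integer using (ℤ; +_; _+_; _-_; _*_; -_; ∣_∣; _<_; 0ℤ; 1ℤ)
open import Data.Product using (Σ; ∃; ∃-syntax; _×_; _,_)
open import Data.Sum using (_⊎_)
open import Relation.Binary.PropositionalEquality using (_≡_; _≢_)

Triple : Set
Triple = ℤ × ℤ × ℤ

InT : ℤ → Triple → Set
InT q (a , b , c) = (a * a + q * (b * b) ≡ c * c) × (0ℤ < c)

Equiv : Triple → Triple → Set
Equiv (a , b , c) (A , B , C) =
  ∃[ m ] ∃[ n ] (m ≢ 0ℤ × n ≢ 0ℤ ×
    (m * a ≡ n * A) × (m * b ≡ n * B) × (∣ m * c ∣ ≡ ∣ n * C ∣))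

addT : ℤ → Triple → Triple → Triple
addT q (a , b , c) (A , B , C) = (a * A - q * (b * B) , a * B + b * A , c * C)

idT : Triple
idT = (1ℤ , 0ℤ , 1ℤ)

negT : Triple → Triple
negT (a , b , c) = (a , - b , c)

IsGenerator : ℤ → Triple → Set
IsGenerator q (a , b , c) =
  InT q (a , b , c) × (0ℤ < a) ×
  (∃[ p ] ((c ≡ + p) × Prime p ×
    (∃[ u ] ∃[ v ] ((c ≡ u * u + q * (v * v)) ⊎ (+ 2 * c ≡ u * u + q * (v * v))))))

data InGenerated (q : ℤ) : Triple → Set where
  gen : ∀ {t} → IsGenerator q t → InGenerated q t
  unit : InGenerated q idT
  neg : ∀ {t} → InGenerated q t → InGenerated q (negT t)
  add : ∀ {s t} → InGenerated q s → InGenerated q t → InGenerated q (addT q s t)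

-- Write N(r, s) = r² + q s² and φ(r, s) = (r² - q s², 2rs, N(r, s)), the triple of (r + s√-q)².
-- A class [a, b, c] with a + c ≠ 0 equals [φ(a + c, b)], so it suffices to show that [φ(r, s)]
-- lies in the generated subgroup, by induction on N(r, s). If s ≠ 0 take a prime p ∣ N(r, s).
-- When p ∣ s, also p ∣ r and we divide by p. Otherwise, for odd p, Thue's lemma gives
-- x² + q y² = kp with 1 ≤ k ≤ q, which a case analysis for q = 2, 3, 5, 6 turns into
-- u² + q v² ∈ {p, 2p}; then [φ(u, v)] is a generator up to sign and scaling, and for the right
-- sign of v, (r + s√-q)(u - v√-q) = p (r′ + s′√-q), so that [φ(r, s)] = [φ(r′, s′)] + [φ(u, v)]
-- with N(r′, s′) < N(r, s). For p = 2 ∤ s, q = 2, 3 allow an explicit such step with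
-- N(u, v) ∈ {2, 4}, while for q = 5, 6 the norm is 6 mod 8 and so has an odd prime factor.

module Submission where

open import Defs
open import Algebra.Bundles using (CommutativeSemigroup)
import Algebra.Properties.CommutativeSemigroup as CommutativeSemigroupProperties
open import Data.Empty using (⊥; ⊥-elim)
open import Data.Fin as Fin using (Fin; toℕ; fromℕ<; remQuot; combine)
import Data.Fin.Properties as Finₚ
open import Data.Integer using (ℤ; +_; -[1+_]; +<+; NonZero; ≢-nonZero; -_; _+_; _-_; _*_; _<_; 0ℤ; 1ℤ; -1ℤ; ∣_∣)
import Data.Integer.Properties as ℤₚ
open import Data.Integer.DivMod using (_%ℕ_; _/ℕ_; a≡a%ℕn+[a/ℕn]*n; n%ℕd<d)
open import Data.Integer.Divisibility.Signed
  using (divides; ∣ᵤ⇒∣; ∣⇒∣ᵤ; ∣m∣n⇒∣m+n; ∣m∣n⇒∣m-n; ∣m+n∣n⇒∣m; ∣m+n∣m⇒∣n; ∣n⇒∣m*n; ∣m⇒∣m*n; ∣-trans; *-cancelʳ-∣; _∣?_)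
  renaming (_∣_ to _∣ℤ_)
open import Data.Integer.Tactic.RingSolver using (solve)
open import Data.List using (List; []; _∷_)
open import Data.List.Relation.Unary.All using (All)
open import Data.Nat as ℕ using (ℕ; zero; suc; z≤n; s≤s)
import Data.Nat.Divisibility as ℕ∣
open import Data.Nat.Induction using (<-rec)
open import Data.Nat.ListAction using (product)
open import Data.Nat.Primality
  using (Prime; prime?; prime[2]; euclidsLemma; prime⇒irreducible; prime⇒nonTrivial; prime⇒nonZero)
open import Data.Nat.Primality.Factorisation using (PrimeFactorisation; factorise)
import Data.Nat.Properties as ℕₚ
open import Data.Product using (_,_; _×_; ∃-syntax; uncurry; proj₁; proj₂)
open import Data.Sum using (_⊎_; inj₁; inj₂; [_,_]′)
open import Function using (id)
open import Relation.Binary.Definitions using (tri<; tri≈; tri>)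
open import Relation.Binary.PropositionalEquality
  using (_≡_; _≢_; ≢-sym; refl; sym; trans; cong; cong₂; subst; subst₂; module ≡-Reasoning)
open import Relation.Nullary using (¬_; Dec; yes; no; contradiction)
open import Relation.Nullary.Decidable using (from-yes; from-no)

-- Equivalence of triples and the generated classes

*-≢0 : ∀ {m n : ℤ} → m ≢ 0ℤ → n ≢ 0ℤ → m * n ≢ 0ℤ
*-≢0 {m} m≢0 n≢0 mn≡0 with ℤₚ.i*j≡0⇒i≡0∨j≡0 m mn≡0
... | inj₁ m≡0 = m≢0 m≡0
... | inj₂ n≡0 = n≢0 n≡0

module _ {c ℓ} (S : CommutativeSemigroup c ℓ) where
  open CommutativeSemigroup S using (_≈_; _∙_; assoc; ∙-congˡ; setoid)
  open CommutativeSemigroupProperties S using (x∙yz≈y∙xz)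
  open import Relation.Binary.Reasoning.Setoid setoid

  ∙-chain : ∀ {m n m′ n′ x y z} → m ∙ x ≈ n ∙ y → m′ ∙ y ≈ n′ ∙ z → (m′ ∙ m) ∙ x ≈ (n ∙ n′) ∙ z
  ∙-chain {m} {n} {m′} {n′} {x} {y} {z} mx≈ny m′y≈n′z = begin
    (m′ ∙ m) ∙ x  ≈⟨ assoc m′ m x ⟩
    m′ ∙ (m ∙ x)  ≈⟨ ∙-congˡ mx≈ny ⟩
    m′ ∙ (n ∙ y)  ≈⟨ x∙yz≈y∙xz m′ n y ⟩
    n ∙ (m′ ∙ y)  ≈⟨ ∙-congˡ m′y≈n′z ⟩
    n ∙ (n′ ∙ z)  ≈⟨ assoc n n′ z ⟨
    (n ∙ n′) ∙ z  ∎

open ≡-Reasoning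

Equiv-refl : ∀ t → Equiv t t
Equiv-refl _ = 1ℤ , 1ℤ , (λ ()) , (λ ()) , refl , refl , refl

≡⇒Equiv : ∀ {t s} → t ≡ s → Equiv t s
≡⇒Equiv {t} refl = Equiv-refl t

Equiv-sym : ∀ {t s} → Equiv t s → Equiv s t
Equiv-sym (m , n , m≢0 , n≢0 , ≡a , ≡b , ≡c) = n , m , n≢0 , m≢0 , sym ≡a , sym ≡b , sym ≡c

Equiv-trans : ∀ {t s u} → Equiv t s → Equiv s u → Equiv t u
Equiv-trans {a , b , c} {A , B , C} {A′ , B′ , C′}
  (m , n , m≢0 , n≢0 , ≡a , ≡b , ≡c) (m′ , n′ , m′≢0 , n′≢0 , ≡a′ , ≡b′ , ≡c′) =
  m′ * m , n * n′ , *-≢0 m′≢0 m≢0 , *-≢0 n≢0 n′≢0 ,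
  chain ≡a ≡a′ , chain ≡b ≡b′ , ∣c∣-chain
  where
  chain : ∀ {x y z} → m * x ≡ n * y → m′ * y ≡ n′ * z → m′ * m * x ≡ n * n′ * z
  chain {x} {y} {z} = ∙-chain ℤₚ.*-commutativeSemigroup {m} {n} {m′} {n′} {x} {y} {z}
  ∣c∣-chain : ∣ m′ * m * c ∣ ≡ ∣ n * n′ * C′ ∣
  ∣c∣-chain = begin
    ∣ m′ * m * c ∣                  ≡⟨ ℤₚ.abs-* (m′ * m) c ⟩
    ∣ m′ * m ∣ ℕ.* ∣ c ∣            ≡⟨ cong (ℕ._* ∣ c ∣) (ℤₚ.abs-* m′ m) ⟩
    ∣ m′ ∣ ℕ.* ∣ m ∣ ℕ.* ∣ c ∣      ≡⟨ ∙-chain ℕₚ.*-commutativeSemigroup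
                                        {∣ m ∣} {∣ n ∣} {∣ m′ ∣} {∣ n′ ∣} {∣ c ∣} {∣ C ∣} {∣ C′ ∣}
                                        (trans (sym (ℤₚ.abs-* m c)) (trans ≡c (ℤₚ.abs-* n C)))
                                        (trans (sym (ℤₚ.abs-* m′ C)) (trans ≡c′ (ℤₚ.abs-* n′ C′))) ⟩
    ∣ n ∣ ℕ.* ∣ n′ ∣ ℕ.* ∣ C′ ∣     ≡⟨ cong (ℕ._* ∣ C′ ∣) (ℤₚ.abs-* n n′) ⟨
    ∣ n * n′ ∣ ℕ.* ∣ C′ ∣           ≡⟨ ℤₚ.abs-* (n * n′) C′ ⟨
    ∣ n * n′ * C′ ∣                 ∎

scaleT : ℤ → Triple → Triple
scaleT k (a , b , c) = (k * a , k * b , k * c)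

scaleT-Equiv : ∀ {k} t → k ≢ 0ℤ → Equiv (scaleT k t) t
scaleT-Equiv {k} (a , b , c) k≢0 =
  1ℤ , k , (λ ()) , k≢0 , ℤₚ.*-identityˡ (k * a) , ℤₚ.*-identityˡ (k * b) , cong ∣_∣ (ℤₚ.*-identityˡ (k * c))

negate-Equiv : ∀ a b c → Equiv (a , b , c) (- a , - b , c)
negate-Equiv a b c =
  1ℤ , -1ℤ , (λ ()) , (λ ()) , solve (a ∷ []) , solve (b ∷ []) , trans (ℤₚ.abs-* 1ℤ c) (sym (ℤₚ.abs-* -1ℤ c))

Homogeneous : (ℤ → ℤ → ℤ) → Set
Homogeneous f = ∀ k a b → k * f a b ≡ f (k * a) (k * b)

homogeneous-resp : ∀ f {m n a b A B} → Homogeneous f →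
                   m * a ≡ n * A → m * b ≡ n * B → m * f a b ≡ n * f A B
homogeneous-resp f {m} {n} {a} {b} {A} {B} hom ma≡nA mb≡nB = begin
  m * f a b          ≡⟨ hom m a b ⟩
  f (m * a) (m * b)  ≡⟨ cong₂ f ma≡nA mb≡nB ⟩
  f (n * A) (n * B)  ≡⟨ hom n A B ⟨
  n * f A B          ∎

Equiv-addTˡ : ∀ q {s s′} t → Equiv s s′ → Equiv (addT q s t) (addT q s′ t)
Equiv-addTˡ q {a , b , c} {A , B , C} (x , y , z) (m , n , m≢0 , n≢0 , ≡a , ≡b , ≡c) =
  m , n , m≢0 , n≢0 ,
  resp (λ a b → a * x - q * (b * y)) (λ k a b → solve (k ∷ a ∷ b ∷ x ∷ y ∷ q ∷ [])) ,
  resp (λ a b → a * y + b * x) (λ k a b → solve (k ∷ a ∷ b ∷ x ∷ y ∷ [])) ,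
  ∣c∣-eq
  where
  resp : ∀ f → Homogeneous f → m * f a b ≡ n * f A B
  resp f hom = homogeneous-resp f {m} {n} {a} {b} {A} {B} hom ≡a ≡b
  ∣c∣-eq : ∣ m * (c * z) ∣ ≡ ∣ n * (C * z) ∣
  ∣c∣-eq = begin
    ∣ m * (c * z) ∣        ≡⟨ cong ∣_∣ (ℤₚ.*-assoc m c z) ⟨
    ∣ m * c * z ∣          ≡⟨ ℤₚ.abs-* (m * c) z ⟩
    ∣ m * c ∣ ℕ.* ∣ z ∣    ≡⟨ cong (ℕ._* ∣ z ∣) ≡c ⟩
    ∣ n * C ∣ ℕ.* ∣ z ∣    ≡⟨ ℤₚ.abs-* (n * C) z ⟨
    ∣ n * C * z ∣          ≡⟨ cong ∣_∣ (ℤₚ.*-assoc n C z) ⟩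
    ∣ n * (C * z) ∣        ∎

addT-comm : ∀ q s t → addT q s t ≡ addT q t s
addT-comm q (a , b , c) (A , B , C) =
  cong₂ _,_ (solve (a ∷ b ∷ A ∷ B ∷ q ∷ [])) (cong₂ _,_ (solve (a ∷ b ∷ A ∷ B ∷ [])) (ℤₚ.*-comm c C))

Equiv-addTʳ : ∀ q s {t t′} → Equiv t t′ → Equiv (addT q s t) (addT q s t′)
Equiv-addTʳ q s {t} {t′} t~t′ =
  Equiv-trans (≡⇒Equiv (addT-comm q s t)) (Equiv-trans (Equiv-addTˡ q s t~t′) (≡⇒Equiv (addT-comm q t′ s)))

Generated : ℤ → Triple → Set
Generated q t = ∃[ s ] (InGenerated q s × Equiv t s)

Generated-resp : ∀ {q t t′} → Equiv t t′ → Generated q t′ → Generated q t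
Generated-resp t~t′ (s , s∈ , t′~s) = s , s∈ , Equiv-trans t~t′ t′~s

Generated-idT : ∀ {q} → Generated q idT
Generated-idT = idT , unit , Equiv-refl idT

Generated-gen : ∀ {q t} → IsGenerator q t → Generated q t
Generated-gen {t = t} t-gen = t , gen t-gen , Equiv-refl t

Generated-addT : ∀ {q s t} → Generated q s → Generated q t → Generated q (addT q s t)
Generated-addT {q} {s} {t} (s′ , s′∈ , s~s′) (t′ , t′∈ , t~t′) =
  addT q s′ t′ , add s′∈ t′∈ , Equiv-trans (Equiv-addTˡ q t s~s′) (Equiv-addTʳ q s′ t~t′)

-- Squares in ℤ[√-q] and the descent step

nrm : ℤ → ℤ → ℤ → ℤ
nrm q r s = r * r + q * (s * s)

φ : ℤ → ℤ → ℤ → Triple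
φ q r s = (r * r - q * (s * s) , + 2 * (r * s) , nrm q r s)

φ-InT : ∀ q r s → 0ℤ < nrm q r s → InT q (φ q r s)
φ-InT q r s 0<N = square-identity , 0<N
  where
  square-identity : (r * r - q * (s * s)) * (r * r - q * (s * s)) + q * ((+ 2 * (r * s)) * (+ 2 * (r * s)))
                  ≡ (r * r + q * (s * s)) * (r * r + q * (s * s))
  square-identity = solve (q ∷ r ∷ s ∷ [])

φ-homogeneous : ∀ q {r s} d r′ s′ → d * r′ ≡ r → d * s′ ≡ s → φ q r s ≡ scaleT (d * d) (φ q r′ s′)
φ-homogeneous q d r′ s′ refl refl = cong₂ _,_ re (cong₂ _,_ im norm)
  where
  re : (d * r′) * (d * r′) - q * ((d * s′) * (d * s′)) ≡ (d * d) * (r′ * r′ - q * (s′ * s′))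
  re = solve (d ∷ r′ ∷ s′ ∷ q ∷ [])
  im : + 2 * ((d * r′) * (d * s′)) ≡ (d * d) * (+ 2 * (r′ * s′))
  im = solve (d ∷ r′ ∷ s′ ∷ [])
  norm : (d * r′) * (d * r′) + q * ((d * s′) * (d * s′)) ≡ (d * d) * (r′ * r′ + q * (s′ * s′))
  norm = solve (d ∷ r′ ∷ s′ ∷ q ∷ [])

addT-scaleTˡ : ∀ q k s t → addT q (scaleT k s) t ≡ scaleT k (addT q s t)
addT-scaleTˡ q k (a , b , c) (A , B , C) = cong₂ _,_ re (cong₂ _,_ im (ℤₚ.*-assoc k c C))
  where
  re : (k * a) * A - q * ((k * b) * B) ≡ k * (a * A - q * (b * B))
  re = solve (k ∷ a ∷ b ∷ A ∷ B ∷ q ∷ [])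
  im : (k * a) * B + (k * b) * A ≡ k * (a * B + b * A)
  im = solve (k ∷ a ∷ b ∷ A ∷ B ∷ [])

-- The components of (r + s√-q)(u - v√-q).
conjMulRe conjMulIm : ℤ → ℤ → ℤ → ℤ → ℤ → ℤ
conjMulRe q r s u v = r * u + q * (s * v)
conjMulIm q r s u v = s * u - r * v

addT-φ-conjMul : ∀ q r s u v →
  addT q (φ q (conjMulRe q r s u v) (conjMulIm q r s u v)) (φ q u v) ≡ scaleT (nrm q u v * nrm q u v) (φ q r s)
addT-φ-conjMul q r s u v = cong₂ _,_ re (cong₂ _,_ im norm)
  where
  re : let X = r * u + q * (s * v) ; Y = s * u - r * v in
       (X * X - q * (Y * Y)) * (u * u - q * (v * v)) - q * ((+ 2 * (X * Y)) * (+ 2 * (u * v)))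
       ≡ ((u * u + q * (v * v)) * (u * u + q * (v * v))) * (r * r - q * (s * s))
  re = solve (q ∷ r ∷ s ∷ u ∷ v ∷ [])
  im : let X = r * u + q * (s * v) ; Y = s * u - r * v in
       (X * X - q * (Y * Y)) * (+ 2 * (u * v)) + (+ 2 * (X * Y)) * (u * u - q * (v * v))
       ≡ ((u * u + q * (v * v)) * (u * u + q * (v * v))) * (+ 2 * (r * s))
  im = solve (q ∷ r ∷ s ∷ u ∷ v ∷ [])
  norm : let X = r * u + q * (s * v) ; Y = s * u - r * v in
         (X * X + q * (Y * Y)) * (u * u + q * (v * v))
         ≡ ((u * u + q * (v * v)) * (u * u + q * (v * v))) * (r * r + q * (s * s))
  norm = solve (q ∷ r ∷ s ∷ u ∷ v ∷ [])

nrm-conjMul : ∀ q r s u v → nrm q (conjMulRe q r s u v) (conjMulIm q r s u v) ≡ nrm q r s * nrm q u v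
nrm-conjMul q r s u v = identity
  where
  identity : let X = r * u + q * (s * v) ; Y = s * u - r * v in
             X * X + q * (Y * Y) ≡ (r * r + q * (s * s)) * (u * u + q * (v * v))
  identity = solve (q ∷ r ∷ s ∷ u ∷ v ∷ [])

-- A descent step for (r, s): (r + s√-q)(u - v√-q) = d (r′ + s′√-q) with
-- N(u, v) < d², so that [φ r s] = [φ r′ s′] + [φ u v] and N(r′, s′) < N(r, s).
record Descent (q r s : ℤ) : Set where
  field
    u v d r′ s′         : ℤ
    d≢0                 : d ≢ 0ℤ
    d*r′≡re             : d * r′ ≡ conjMulRe q r s u v
    d*s′≡im             : d * s′ ≡ conjMulIm q r s u v
    nrm[u,v]≢0          : nrm q u v ≢ 0ℤ
    ∣nrm[u,v]∣<∣d∣²     : ∣ nrm q u v ∣ ℕ.< ∣ d ∣ ℕ.* ∣ d ∣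
    generated-φ[u,v]         : Generated q (φ q u v)

module _ {q r s} (D : Descent q r s) where
  open Descent D

  descent-Generated : Generated q (φ q r′ s′) → Generated q (φ q r s)
  descent-Generated generated-φ[r′,s′] = Generated-resp φ[r,s]~sum (Generated-addT generated-φ[r′,s′] generated-φ[u,v])
    where
    N = nrm q u v
    scaled-sum : scaleT (N * N) (φ q r s) ≡ scaleT (d * d) (addT q (φ q r′ s′) (φ q u v))
    scaled-sum = begin
      scaleT (N * N) (φ q r s)
        ≡⟨ addT-φ-conjMul q r s u v ⟨
      addT q (φ q (conjMulRe q r s u v) (conjMulIm q r s u v)) (φ q u v)
        ≡⟨ cong (λ t → addT q t (φ q u v)) (φ-homogeneous q d r′ s′ d*r′≡re d*s′≡im) ⟩
      addT q (scaleT (d * d) (φ q r′ s′)) (φ q u v)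
        ≡⟨ addT-scaleTˡ q (d * d) (φ q r′ s′) (φ q u v) ⟩
      scaleT (d * d) (addT q (φ q r′ s′) (φ q u v))
        ∎
    φ[r,s]~sum : Equiv (φ q r s) (addT q (φ q r′ s′) (φ q u v))
    φ[r,s]~sum = Equiv-trans (Equiv-sym (scaleT-Equiv (φ q r s) (*-≢0 nrm[u,v]≢0 nrm[u,v]≢0)))
                   (Equiv-trans (≡⇒Equiv scaled-sum) (scaleT-Equiv (addT q (φ q r′ s′) (φ q u v)) (*-≢0 d≢0 d≢0)))

  descent-nrm : (d * d) * nrm q r′ s′ ≡ nrm q r s * nrm q u v
  descent-nrm = trans (sym (cong (λ t → proj₂ (proj₂ t)) (φ-homogeneous q d r′ s′ d*r′≡re d*s′≡im)))
                      (nrm-conjMul q r s u v)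

  descent-nrm≢0 : nrm q r s ≢ 0ℤ → nrm q r′ s′ ≢ 0ℤ
  descent-nrm≢0 N≢0 N′≡0 = *-≢0 N≢0 nrm[u,v]≢0
    (trans (sym descent-nrm) (trans (cong ((d * d) *_) N′≡0) (ℤₚ.*-zeroʳ (d * d))))

  descent-decreases : nrm q r s ≢ 0ℤ → ∣ nrm q r′ s′ ∣ ℕ.< ∣ nrm q r s ∣
  descent-decreases N≢0 = ℕₚ.*-cancelˡ-< ∣d∣² ∣ nrm q r′ s′ ∣ ∣N∣
    (subst₂ ℕ._<_ (sym ∣descent-nrm∣) (ℕₚ.*-comm ∣N∣ ∣d∣²) (ℕₚ.*-monoʳ-< ∣N∣ ∣nrm[u,v]∣<∣d∣²))
    where
    ∣N∣ = ∣ nrm q r s ∣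
    ∣d∣² = ∣ d ∣ ℕ.* ∣ d ∣
    instance
      ∣N∣-nonZero : ℕ.NonZero ∣N∣
      ∣N∣-nonZero = ℕ.≢-nonZero (λ ∣N∣≡0 → N≢0 (ℤₚ.∣i∣≡0⇒i≡0 ∣N∣≡0))
    ∣descent-nrm∣ : ∣d∣² ℕ.* ∣ nrm q r′ s′ ∣ ≡ ∣N∣ ℕ.* ∣ nrm q u v ∣
    ∣descent-nrm∣ = begin
      ∣d∣² ℕ.* ∣ nrm q r′ s′ ∣           ≡⟨ cong (ℕ._* ∣ nrm q r′ s′ ∣) (ℤₚ.abs-* d d) ⟨
      ∣ d * d ∣ ℕ.* ∣ nrm q r′ s′ ∣      ≡⟨ ℤₚ.abs-* (d * d) (nrm q r′ s′) ⟨
      ∣ d * d * nrm q r′ s′ ∣            ≡⟨ cong ∣_∣ descent-nrm ⟩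
      ∣ nrm q r s * nrm q u v ∣          ≡⟨ ℤₚ.abs-* (nrm q r s) (nrm q u v) ⟩
      ∣N∣ ℕ.* ∣ nrm q u v ∣              ∎

φ-real : ∀ q r → φ q r 0ℤ ≡ scaleT (r * r) idT
φ-real q r = cong₂ _,_ re (cong₂ _,_ im norm)
  where
  re : r * r - q * (0ℤ * 0ℤ) ≡ r * r * 1ℤ
  re = solve (r ∷ q ∷ [])
  im : + 2 * (r * 0ℤ) ≡ r * r * 0ℤ
  im = solve (r ∷ [])
  norm : r * r + q * (0ℤ * 0ℤ) ≡ r * r * 1ℤ
  norm = solve (r ∷ q ∷ [])

Generated-φ-real : ∀ q r → r * r ≢ 0ℤ → Generated q (φ q r 0ℤ)
Generated-φ-real q r r²≢0 = Generated-resp (Equiv-trans (≡⇒Equiv (φ-real q r)) (scaleT-Equiv idT r²≢0)) Generated-idT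

module _ (q : ℤ) (descent : ∀ r s → s ≢ 0ℤ → Descent q r s) where

  Generated-φ : ∀ r s → nrm q r s ≢ 0ℤ → Generated q (φ q r s)
  Generated-φ r s = <-rec P step ∣ nrm q r s ∣ r s refl
    where
    P : ℕ → Set
    P n = ∀ r s → ∣ nrm q r s ∣ ≡ n → nrm q r s ≢ 0ℤ → Generated q (φ q r s)
    step : ∀ n → (∀ {m} → m ℕ.< n → P m) → P n
    step _ IH r s refl N≢0 with s ℤₚ.≟ 0ℤ
    ... | yes refl = Generated-φ-real q r r²≢0
      where
      r²≢0 : r * r ≢ 0ℤ
      r²≢0 r²≡0 = N≢0 (trans (cong (λ t → proj₂ (proj₂ t)) (φ-real q r)) (trans (ℤₚ.*-identityʳ (r * r)) r²≡0))
    ... | no s≢0 = descent-Generated D (IH (descent-decreases D N≢0) r′ s′ refl (descent-nrm≢0 D N≢0))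
      where
      D = descent r s s≢0
      open Descent D using (r′; s′)

module _ (q : ℤ) (q≢0 : q ≢ 0ℤ) (generated-φ : ∀ r s → nrm q r s ≢ 0ℤ → Generated q (φ q r s)) where

  InT⇒Generated-via-φ : ∀ t → InT q t → Generated q t
  InT⇒Generated-via-φ (a , b , c) (a²+qb²≡c² , 0<c) with a + c ℤₚ.≟ 0ℤ
  ... | yes a+c≡0 =
    Generated-resp (Equiv-trans (negate-Equiv a b c) (Equiv-trans (≡⇒Equiv opposite≡) (scaleT-Equiv idT c≢0))) Generated-idT
    where
    c≢0 : c ≢ 0ℤ
    c≢0 = ≢-sym (ℤₚ.<⇒≢ 0<c)
    a≡-c : a ≡ - c
    a≡-c = begin
      a            ≡⟨ solve (a ∷ c ∷ []) ⟩
      (a + c) - c  ≡⟨ cong (_- c) a+c≡0 ⟩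
      0ℤ - c       ≡⟨ solve (c ∷ []) ⟩
      - c          ∎
    qb²≡0 : q * (b * b) ≡ 0ℤ
    qb²≡0 = begin
      q * (b * b)                        ≡⟨ solve (a ∷ b ∷ q ∷ []) ⟩
      (a * a + q * (b * b)) - a * a      ≡⟨ cong₂ (λ x y → x - y * y) a²+qb²≡c² a≡-c ⟩
      c * c - (- c) * (- c)              ≡⟨ solve (c ∷ []) ⟩
      0ℤ                                 ∎
    b≡0 : b ≡ 0ℤ
    b≡0 with ℤₚ.i*j≡0⇒i≡0∨j≡0 q qb²≡0
    ... | inj₁ q≡0 = ⊥-elim (q≢0 q≡0)
    ... | inj₂ b²≡0 with ℤₚ.i*j≡0⇒i≡0∨j≡0 b b²≡0
    ...   | inj₁ b≡0 = b≡0
    ...   | inj₂ b≡0 = b≡0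
    opposite≡ : (- a , - b , c) ≡ scaleT c idT
    opposite≡ = cong₂ _,_ (trans (cong -_ a≡-c) (solve (c ∷ [])))
                  (cong₂ _,_ (trans (cong -_ b≡0) (solve (c ∷ []))) (solve (c ∷ [])))
  ... | no a+c≢0 =
    Generated-resp (Equiv-sym (Equiv-trans (≡⇒Equiv φ≡scaled) (scaleT-Equiv (a , b , c) k≢0))) (generated-φ (a + c) b N≢0)
    where
    k = + 2 * (a + c)
    k≢0 : k ≢ 0ℤ
    k≢0 = *-≢0 {+ 2} (λ ()) a+c≢0
    re : (a + c) * (a + c) - q * (b * b) ≡ + 2 * (a + c) * a
    re = begin
      (a + c) * (a + c) - q * (b * b)                        ≡⟨ solve (a ∷ b ∷ c ∷ q ∷ []) ⟩
      + 2 * (a + c) * a + (c * c - (a * a + q * (b * b)))    ≡⟨ cong (λ x → + 2 * (a + c) * a + (c * c - x)) a²+qb²≡c² ⟩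
      + 2 * (a + c) * a + (c * c - c * c)                    ≡⟨ solve (a ∷ c ∷ []) ⟩
      + 2 * (a + c) * a                                      ∎
    norm : (a + c) * (a + c) + q * (b * b) ≡ + 2 * (a + c) * c
    norm = begin
      (a + c) * (a + c) + q * (b * b)                        ≡⟨ solve (a ∷ b ∷ c ∷ q ∷ []) ⟩
      + 2 * (a + c) * c - (c * c - (a * a + q * (b * b)))    ≡⟨ cong (λ x → + 2 * (a + c) * c - (c * c - x)) a²+qb²≡c² ⟩
      + 2 * (a + c) * c - (c * c - c * c)                    ≡⟨ solve (a ∷ c ∷ []) ⟩
      + 2 * (a + c) * c                                      ∎
    im : + 2 * ((a + c) * b) ≡ + 2 * (a + c) * b
    im = solve (a ∷ b ∷ c ∷ [])
    φ≡scaled : φ q (a + c) b ≡ scaleT k (a , b , c)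
    φ≡scaled = cong₂ _,_ re (cong₂ _,_ im norm)
    N≢0 : nrm q (a + c) b ≢ 0ℤ
    N≢0 N≡0 = *-≢0 k≢0 (≢-sym (ℤₚ.<⇒≢ 0<c)) (trans (sym norm) N≡0)

-- Descent at a prime divisor of the norm

prime⇒2≤ : ∀ {p} → Prime p → 2 ℕ.≤ p
prime⇒2≤ {p} p-prime = ℕ.nonTrivial⇒n>1 p {{prime⇒nonTrivial p-prime}}

prime⇒+≢0 : ∀ {p} → Prime p → + p ≢ 0ℤ
prime⇒+≢0 p-prime p≡0 = ℕₚ.<⇒≢ (ℕₚ.≤-trans (s≤s z≤n) (prime⇒2≤ p-prime)) (sym (ℤₚ.+-injective p≡0))

prime≢square : ∀ {p} → Prime p → ∀ k → p ≢ k ℕ.* k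
prime≢square {p} p-prime k p≡k² with prime⇒irreducible p-prime (ℕ∣.divides k p≡k²)
... | inj₁ refl = ℕₚ.<⇒≢ (prime⇒2≤ p-prime) (sym p≡k²)
... | inj₂ refl = ℕₚ.<⇒≢ (ℕₚ.m<m*n p p {{prime⇒nonZero p-prime}} (prime⇒2≤ p-prime)) p≡k²

prime-∣-* : ∀ {p} x y → Prime p → (+ p) ∣ℤ x * y → (+ p) ∣ℤ x ⊎ (+ p) ∣ℤ y
prime-∣-* x y p-prime p∣xy
  with euclidsLemma ∣ x ∣ ∣ y ∣ p-prime (subst (_ ℕ∣.∣_) (ℤₚ.abs-* x y) (∣⇒∣ᵤ p∣xy))
... | inj₁ p∣x = inj₁ (∣ᵤ⇒∣ p∣x)
... | inj₂ p∣y = inj₂ (∣ᵤ⇒∣ p∣y)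

prime-∣-square : ∀ {p} x → Prime p → (+ p) ∣ℤ x * x → (+ p) ∣ℤ x
prime-∣-square x p-prime p∣x² = [ (λ p∣x → p∣x) , (λ p∣x → p∣x) ]′ (prime-∣-* x x p-prime p∣x²)

prime-∣-*ʳ : ∀ {ℓ a b} → Prime ℓ → ¬ (+ ℓ) ∣ℤ a → (+ ℓ) ∣ℤ a * b → (+ ℓ) ∣ℤ b
prime-∣-*ʳ {a = a} {b} ℓ-prime ℓ∤a ℓ∣ab = [ (λ ℓ∣a → ⊥-elim (ℓ∤a ℓ∣a)) , id ]′ (prime-∣-* a b ℓ-prime ℓ∣ab)

square≡+ : ∀ i → i * i ≡ + (∣ i ∣ ℕ.* ∣ i ∣)
square≡+ (+ n) = sym (ℤₚ.pos-* n n)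
square≡+ -[1+ n ] = refl

nrm≡+ : ∀ q₀ r s → nrm (+ q₀) r s ≡ + (∣ r ∣ ℕ.* ∣ r ∣ ℕ.+ q₀ ℕ.* (∣ s ∣ ℕ.* ∣ s ∣))
nrm≡+ q₀ r s = begin
  r * r + + q₀ * (s * s)                                      ≡⟨ cong₂ (λ x y → x + + q₀ * y) (square≡+ r) (square≡+ s) ⟩
  + (∣ r ∣ ℕ.* ∣ r ∣) + + q₀ * + (∣ s ∣ ℕ.* ∣ s ∣)             ≡⟨ cong (_+_ (+ (∣ r ∣ ℕ.* ∣ r ∣))) (ℤₚ.pos-* q₀ _) ⟨
  + (∣ r ∣ ℕ.* ∣ r ∣) + + (q₀ ℕ.* (∣ s ∣ ℕ.* ∣ s ∣))           ≡⟨ ℤₚ.pos-+ (∣ r ∣ ℕ.* ∣ r ∣) _ ⟨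
  + (∣ r ∣ ℕ.* ∣ r ∣ ℕ.+ q₀ ℕ.* (∣ s ∣ ℕ.* ∣ s ∣))             ∎

descent-common-factor : ∀ {q r s k} → 2 ℕ.≤ k → (+ k) ∣ℤ r → (+ k) ∣ℤ s → Descent q r s
descent-common-factor {q} {r} {s} {k} 2≤k (divides r′ r≡r′k) (divides s′ s≡s′k) = record
  { u = 1ℤ ; v = 0ℤ ; d = + k ; r′ = r′ ; s′ = s′
  ; d≢0 = λ k≡0 → ℕₚ.<⇒≢ (ℕₚ.≤-trans (s≤s z≤n) 2≤k) (sym (ℤₚ.+-injective k≡0))
  ; d*r′≡re = trans (ℤₚ.*-comm (+ k) r′) (trans (sym r≡r′k) re)
  ; d*s′≡im = trans (ℤₚ.*-comm (+ k) s′) (trans (sym s≡s′k) im)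
  ; nrm[u,v]≢0 = λ N≡0 → ℤₚ.<⇒≢ (+<+ (s≤s z≤n)) (sym (trans (sym norm) N≡0))
  ; ∣nrm[u,v]∣<∣d∣² = subst (ℕ._< k ℕ.* k) (sym (cong ∣_∣ norm))
                        (ℕₚ.≤-trans 2≤k (ℕₚ.m≤m*n k k {{ℕ.>-nonZero (ℕₚ.≤-trans (s≤s z≤n) 2≤k)}}))
  ; generated-φ[u,v] = Generated-φ-real q 1ℤ (λ ())
  }
  where
  re : r ≡ r * 1ℤ + q * (s * 0ℤ)
  re = solve (r ∷ s ∷ q ∷ [])
  im : s ≡ s * 1ℤ - r * 0ℤ
  im = solve (r ∷ s ∷ [])
  norm : 1ℤ * 1ℤ + q * (0ℤ * 0ℤ) ≡ 1ℤ
  norm = solve (q ∷ [])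

GeneratorHypotenuse : ℤ → ℤ → Set
GeneratorHypotenuse q c =
  ∃[ p ] ((c ≡ + p) × Prime p × (∃[ u ] ∃[ v ] ((c ≡ u * u + q * (v * v)) ⊎ (+ 2 * c ≡ u * u + q * (v * v)))))

Generated-±gen : ∀ {q a b c} → InT q (a , b , c) → a ≢ 0ℤ → GeneratorHypotenuse q c → Generated q (a , b , c)
Generated-±gen {q} {a} {b} {c} (a²+qb²≡c² , 0<c) a≢0 hyp with ℤₚ.<-cmp 0ℤ a
... | tri< 0<a _ _ = Generated-gen ((a²+qb²≡c² , 0<c) , 0<a , hyp)
... | tri≈ _ 0≡a _ = ⊥-elim (a≢0 (sym 0≡a))
... | tri> _ _ a<0 =
  Generated-resp (negate-Equiv a b c) (Generated-gen ((trans negated a²+qb²≡c² , 0<c) , ℤₚ.neg-mono-< a<0 , hyp))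
  where
  negated : (- a) * (- a) + q * ((- b) * (- b)) ≡ a * a + q * (b * b)
  negated = solve (a ∷ b ∷ q ∷ [])

Generated-φ-prime-norm : ∀ {q₀ p} u v → 2 ℕ.≤ q₀ → Prime p → nrm (+ q₀) u v ≡ + p → Generated (+ q₀) (φ (+ q₀) u v)
Generated-φ-prime-norm {q₀} {p} u v 2≤q₀ p-prime N≡p =
  Generated-±gen (φ-InT q u v 0<N) a≢0 (p , N≡p , p-prime , u , v , inj₁ refl)
  where
  q = + q₀
  U = ∣ u ∣ ℕ.* ∣ u ∣
  V = ∣ v ∣ ℕ.* ∣ v ∣
  0<N : 0ℤ < nrm q u v
  0<N = subst (0ℤ <_) (sym N≡p) (+<+ (ℕₚ.≤-trans (s≤s z≤n) (prime⇒2≤ p-prime)))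
  -- u² = q v² would make p = 2u² with u² ∣ p, forcing u² = 1 (then q v² = 1) or u² = p (then p = 0).
  a≢0 : u * u - q * (v * v) ≢ 0ℤ
  a≢0 a≡0 = U-cases (prime⇒irreducible p-prime (ℕ∣.divides 2 (trans p≡U+U (cong (U ℕ.+_) (sym (ℕₚ.+-identityʳ U))))))
    where
    U≡q₀V : U ≡ q₀ ℕ.* V
    U≡q₀V = ℤₚ.+-injective (begin
      + U             ≡⟨ square≡+ u ⟨
      u * u           ≡⟨ ℤₚ.i-j≡0⇒i≡j _ _ a≡0 ⟩
      q * (v * v)     ≡⟨ cong (q *_) (square≡+ v) ⟩
      q * + V         ≡⟨ ℤₚ.pos-* q₀ V ⟨
      + (q₀ ℕ.* V)    ∎)
    p≡U+U : p ≡ U ℕ.+ U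
    p≡U+U = ℤₚ.+-injective (trans (sym N≡p) (trans (nrm≡+ q₀ u v) (cong (λ x → + (U ℕ.+ x)) (sym U≡q₀V))))
    U-cases : U ≡ 1 ⊎ U ≡ p → ⊥
    U-cases (inj₁ U≡1) = ℕₚ.<⇒≢ 2≤q₀ (sym (ℕₚ.m*n≡1⇒m≡1 q₀ V (trans (sym U≡q₀V) U≡1)))
    U-cases (inj₂ U≡p) = ℕₚ.<⇒≢ (ℕₚ.≤-trans (s≤s z≤n) (prime⇒2≤ p-prime))
      (sym (ℕₚ.+-cancelˡ-≡ p p 0 (trans (sym (trans p≡U+U (cong₂ ℕ._+_ U≡p U≡p))) (sym (ℕₚ.+-identityʳ p)))))

module _ (q u v P : ℤ) (N≡2P : nrm q u v ≡ + 2 * P) where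

  φ-halved : φ q u v ≡ scaleT (+ 2) (P - q * (v * v) , u * v , P)
  φ-halved = cong₂ _,_ re (cong₂ _,_ im N≡2P)
    where
    re : u * u - q * (v * v) ≡ + 2 * (P - q * (v * v))
    re = begin
      u * u - q * (v * v)                           ≡⟨ solve (u ∷ v ∷ q ∷ []) ⟩
      (u * u + q * (v * v)) - + 2 * (q * (v * v))   ≡⟨ cong (_- + 2 * (q * (v * v))) N≡2P ⟩
      + 2 * P - + 2 * (q * (v * v))                 ≡⟨ solve (v ∷ q ∷ P ∷ []) ⟩
      + 2 * (P - q * (v * v))                       ∎
    im : + 2 * (u * v) ≡ + 2 * (u * v)
    im = refl

  halved-InT-eq : (P - q * (v * v)) * (P - q * (v * v)) + q * ((u * v) * (u * v)) ≡ P * P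
  halved-InT-eq = begin
    (P - q * (v * v)) * (P - q * (v * v)) + q * ((u * v) * (u * v))
      ≡⟨ solve (u ∷ v ∷ q ∷ P ∷ []) ⟩
    (P - q * (v * v)) * (P - q * (v * v)) + q * (v * v) * ((u * u + q * (v * v)) - q * (v * v))
      ≡⟨ cong (λ N → (P - q * (v * v)) * (P - q * (v * v)) + q * (v * v) * (N - q * (v * v))) N≡2P ⟩
    (P - q * (v * v)) * (P - q * (v * v)) + q * (v * v) * (+ 2 * P - q * (v * v))
      ≡⟨ solve (v ∷ q ∷ P ∷ []) ⟩
    P * P
      ∎

  halved-square : P ≡ q * (v * v) → u * u ≡ P
  halved-square P≡qv² = begin
    u * u                              ≡⟨ solve (u ∷ v ∷ q ∷ []) ⟩
    (u * u + q * (v * v)) - q * (v * v) ≡⟨ cong₂ _-_ N≡2P (sym P≡qv²) ⟩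
    + 2 * P - P                        ≡⟨ solve (P ∷ []) ⟩
    P                                  ∎

Generated-φ-twice-prime-norm : ∀ {q p} u v → Prime p → nrm q u v ≡ + 2 * + p → Generated q (φ q u v)
Generated-φ-twice-prime-norm {q} {p} u v p-prime N≡2p =
  Generated-resp (Equiv-trans (≡⇒Equiv (φ-halved q u v (+ p) N≡2p)) (scaleT-Equiv {+ 2} half (λ ())))
    (Generated-±gen (halved-InT-eq q u v (+ p) N≡2p , +<+ (ℕₚ.≤-trans (s≤s z≤n) (prime⇒2≤ p-prime)))
                           a≢0 (p , refl , p-prime , u , v , inj₂ (sym N≡2p)))
  where
  half = (+ p - q * (v * v) , u * v , + p)
  a≢0 : + p - q * (v * v) ≢ 0ℤ
  a≢0 a≡0 = prime≢square p-prime ∣ u ∣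
    (ℤₚ.+-injective (trans (sym (halved-square q u v (+ p) N≡2p (ℤₚ.i-j≡0⇒i≡j _ _ a≡0))) (square≡+ u)))

nrm-neg : ∀ q u v → nrm q u (- v) ≡ nrm q u v
nrm-neg q u v = identity
  where
  identity : u * u + q * ((- v) * (- v)) ≡ u * u + q * (v * v)
  identity = solve (u ∷ v ∷ q ∷ [])

data Norm≡p∨2p (q P u v : ℤ) : Set where
  norm≡p  : nrm q u v ≡ P → Norm≡p∨2p q P u v
  norm≡2p : nrm q u v ≡ + 2 * P → Norm≡p∨2p q P u v

Represents : ℤ → ℤ → Set
Represents q P = ∃[ u ] ∃[ v ] Norm≡p∨2p q P u v

module _ {q P u v : ℤ} where

  Norm≡p∨2p⇒∣2p : Norm≡p∨2p q P u v → nrm q u v ∣ℤ + 2 * P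
  Norm≡p∨2p⇒∣2p (norm≡p N≡P) = divides (+ 2) (cong (+ 2 *_) (sym N≡P))
  Norm≡p∨2p⇒∣2p (norm≡2p N≡2P) = divides 1ℤ (sym (trans (ℤₚ.*-identityˡ (nrm q u v)) N≡2P))

  Norm≡p∨2p⇒p∣ : Norm≡p∨2p q P u v → P ∣ℤ nrm q u v
  Norm≡p∨2p⇒p∣ (norm≡p N≡P) = divides 1ℤ (trans N≡P (sym (ℤₚ.*-identityˡ P)))
  Norm≡p∨2p⇒p∣ (norm≡2p N≡2P) = divides (+ 2) N≡2P

  Norm≡p∨2p-neg : Norm≡p∨2p q P u v → Norm≡p∨2p q P u (- v)
  Norm≡p∨2p-neg (norm≡p N≡P) = norm≡p (trans (nrm-neg q u v) N≡P)
  Norm≡p∨2p-neg (norm≡2p N≡2P) = norm≡2p (trans (nrm-neg q u v) N≡2P)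

module _ {q : ℤ} {p : ℕ} {u v : ℤ} where

  -- p² ∣ N(u, v) ∣ 2p would give p ∣ 2.
  Norm≡p∨2p⇒¬p∣both : Prime p → 3 ℕ.≤ p → Norm≡p∨2p q (+ p) u v → (+ p) ∣ℤ u → (+ p) ∣ℤ v → ⊥
  Norm≡p∨2p⇒¬p∣both p-prime 3≤p N≡p∨2p (divides a u≡ap) (divides b v≡bp) =
    ℕₚ.<⇒≱ 3≤p (ℕ∣.∣⇒≤ (∣⇒∣ᵤ p∣2))
    where
    instance
      +p-nonZero : NonZero (+ p)
      +p-nonZero = ≢-nonZero (prime⇒+≢0 p-prime)
    p²∣N : (+ p * + p) ∣ℤ nrm q u v
    p²∣N = divides (a * a + q * (b * b)) (begin
      u * u + q * (v * v)                  ≡⟨ cong₂ (λ x y → x * x + q * (y * y)) u≡ap v≡bp ⟩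
      (a * + p) * (a * + p) + q * ((b * + p) * (b * + p))
                                           ≡⟨ factor (+ p) ⟩
      (a * a + q * (b * b)) * (+ p * + p)  ∎)
      where
      factor : ∀ P → (a * P) * (a * P) + q * ((b * P) * (b * P)) ≡ (a * a + q * (b * b)) * (P * P)
      factor P = solve (a ∷ b ∷ q ∷ P ∷ [])
    p∣2 : (+ p) ∣ℤ + 2
    p∣2 = *-cancelʳ-∣ (+ p) (∣-trans p²∣N (Norm≡p∨2p⇒∣2p N≡p∨2p))

module _ {q : ℤ} {p : ℕ} {r s : ℤ} (p-prime : Prime p) (3≤p : 3 ℕ.≤ p)
         (p∣N : (+ p) ∣ℤ nrm q r s) (p∤s : ¬ (+ p) ∣ℤ s) where

  conjMulRe-divisible : ∀ {u v} → Norm≡p∨2p q (+ p) u v →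
                        (+ p) ∣ℤ conjMulIm q r s u v → (+ p) ∣ℤ conjMulRe q r s u v
  conjMulRe-divisible {u} {v} N≡p∨2p p∣Y = [ (λ p∣v → ⊥-elim (p∤v p∣v)) , id ]′ (prime-∣-* v _ p-prime p∣vX)
    where
    vX≡ : v * (r * u + q * (s * v)) ≡ s * (u * u + q * (v * v)) - u * (s * u - r * v)
    vX≡ = solve (q ∷ r ∷ s ∷ u ∷ v ∷ [])
    p∣vX : (+ p) ∣ℤ v * conjMulRe q r s u v
    p∣vX = subst ((+ p) ∣ℤ_) (sym vX≡) (∣m∣n⇒∣m-n (∣n⇒∣m*n s (Norm≡p∨2p⇒p∣ N≡p∨2p)) (∣n⇒∣m*n u p∣Y))
    su≡ : (s * u - r * v) + r * v ≡ s * u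
    su≡ = solve (r ∷ s ∷ u ∷ v ∷ [])
    p∤v : ¬ (+ p) ∣ℤ v
    p∤v p∣v = [ p∤s , (λ p∣u → Norm≡p∨2p⇒¬p∣both p-prime 3≤p N≡p∨2p p∣u p∣v) ]′
      (prime-∣-* s u p-prime (subst ((+ p) ∣ℤ_) su≡ (∣m∣n⇒∣m+n p∣Y (∣n⇒∣m*n r p∣v))))

  -- p divides s²N(u, v) - v²N(r, s) = (su - rv)(su + rv).
  conjMul-divisible : ∀ {u v} → Norm≡p∨2p q (+ p) u v →
    ∃[ v′ ] (Norm≡p∨2p q (+ p) u v′ × (+ p) ∣ℤ conjMulRe q r s u v′ × (+ p) ∣ℤ conjMulIm q r s u v′)
  conjMul-divisible {u} {v} N≡p∨2p =
    [ (λ p∣Y → v , N≡p∨2p , conjMulRe-divisible N≡p∨2p p∣Y , p∣Y)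
    , (λ p∣Y → - v , N≡p∨2p′ , conjMulRe-divisible N≡p∨2p′ p∣Y , p∣Y)
    ]′ (prime-∣-* (conjMulIm q r s u v) (conjMulIm q r s u (- v)) p-prime p∣product)
    where
    N≡p∨2p′ = Norm≡p∨2p-neg N≡p∨2p
    product≡ : s * s * (u * u + q * (v * v)) - v * v * (r * r + q * (s * s)) ≡ (s * u - r * v) * (s * u - r * (- v))
    product≡ = solve (q ∷ r ∷ s ∷ u ∷ v ∷ [])
    p∣product : (+ p) ∣ℤ conjMulIm q r s u v * conjMulIm q r s u (- v)
    p∣product = subst ((+ p) ∣ℤ_) product≡
      (∣m∣n⇒∣m-n (∣n⇒∣m*n (s * s) (Norm≡p∨2p⇒p∣ N≡p∨2p)) (∣n⇒∣m*n (v * v) p∣N))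

prime-divisor : ∀ n → 2 ℕ.≤ n → ∃[ p ] (Prime p × p ℕ∣.∣ n)
prime-divisor n 2≤n = from-factors (PrimeFactorisation.factors f) (PrimeFactorisation.isFactorisation f)
                                   (PrimeFactorisation.factorsPrime f)
  where
  f = factorise n {{ℕ.>-nonZero (ℕₚ.≤-trans (s≤s z≤n) 2≤n)}}
  from-factors : (ps : List ℕ) → n ≡ product ps → All Prime ps → ∃[ p ] (Prime p × p ℕ∣.∣ n)
  from-factors [] n≡1 _ = ⊥-elim (ℕₚ.<⇒≢ 2≤n (sym n≡1))
  from-factors (p ∷ ps) n≡p*ps (p-prime All.∷ _) =
    p , p-prime , ℕ∣.divides (product ps) (trans n≡p*ps (ℕₚ.*-comm p (product ps)))

q₀≤∣nrm∣ : ∀ q₀ r s → s ≢ 0ℤ → q₀ ℕ.≤ ∣ nrm (+ q₀) r s ∣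
q₀≤∣nrm∣ q₀ r s s≢0 = ℕₚ.≤-trans (ℕₚ.m≤m*n q₀ S {{S-nonZero}})
  (subst (q₀ ℕ.* S ℕ.≤_) (sym (cong ∣_∣ (nrm≡+ q₀ r s))) (ℕₚ.m≤n+m (q₀ ℕ.* S) (∣ r ∣ ℕ.* ∣ r ∣)))
  where
  S = ∣ s ∣ ℕ.* ∣ s ∣
  S-nonZero : ℕ.NonZero S
  S-nonZero = ℕₚ.m*n≢0 ∣ s ∣ ∣ s ∣ {{∣s∣-nonZero}} {{∣s∣-nonZero}}
    where
    ∣s∣-nonZero = ℕ.≢-nonZero (λ ∣s∣≡0 → s≢0 (ℤₚ.∣i∣≡0⇒i≡0 ∣s∣≡0))

module _ {q₀ : ℕ} (2≤q₀ : 2 ℕ.≤ q₀) {r s : ℤ} {p : ℕ} (p-prime : Prime p) (3≤p : 3 ℕ.≤ p) where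

  descent-prime-norm : ∀ {u v} → Norm≡p∨2p (+ q₀) (+ p) u v → (+ p) ∣ℤ conjMulRe (+ q₀) r s u v →
                       (+ p) ∣ℤ conjMulIm (+ q₀) r s u v → Descent (+ q₀) r s
  descent-prime-norm {u} {v} N≡p∨2p (divides r′ X≡r′p) (divides s′ Y≡s′p) = record
    { u = u ; v = v ; d = + p ; r′ = r′ ; s′ = s′
    ; d≢0 = prime⇒+≢0 p-prime
    ; d*r′≡re = trans (ℤₚ.*-comm (+ p) r′) (sym X≡r′p)
    ; d*s′≡im = trans (ℤₚ.*-comm (+ p) s′) (sym Y≡s′p)
    ; nrm[u,v]≢0 = nonzero N≡p∨2p
    ; ∣nrm[u,v]∣<∣d∣² = bound N≡p∨2p
    ; generated-φ[u,v] = generated N≡p∨2p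
    }
    where
    instance
      p-nonZero : ℕ.NonZero p
      p-nonZero = prime⇒nonZero p-prime
    nonzero : Norm≡p∨2p (+ q₀) (+ p) u v → nrm (+ q₀) u v ≢ 0ℤ
    nonzero (norm≡p N≡p) N≡0 = prime⇒+≢0 p-prime (trans (sym N≡p) N≡0)
    nonzero (norm≡2p N≡2p) N≡0 = *-≢0 {+ 2} (λ ()) (prime⇒+≢0 p-prime) (trans (sym N≡2p) N≡0)
    bound : Norm≡p∨2p (+ q₀) (+ p) u v → ∣ nrm (+ q₀) u v ∣ ℕ.< p ℕ.* p
    bound (norm≡p N≡p) = subst (ℕ._< p ℕ.* p) (sym (cong ∣_∣ N≡p)) (ℕₚ.m<m*n p p (prime⇒2≤ p-prime))
    bound (norm≡2p N≡2p) = subst (ℕ._< p ℕ.* p) (sym (trans (cong ∣_∣ N≡2p) (ℤₚ.abs-* (+ 2) (+ p))))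
                              (ℕₚ.*-monoˡ-< p 3≤p)
    generated : Norm≡p∨2p (+ q₀) (+ p) u v → Generated (+ q₀) (φ (+ q₀) u v)
    generated (norm≡p N≡p) = Generated-φ-prime-norm u v 2≤q₀ p-prime N≡p
    generated (norm≡2p N≡2p) = Generated-φ-twice-prime-norm u v p-prime N≡2p

RepresentsOddPrimeDivisors : ℕ → Set
RepresentsOddPrimeDivisors q₀ = ∀ {p} r s → Prime p → 3 ℕ.≤ p →
  (+ p) ∣ℤ nrm (+ q₀) r s → ¬ (+ p) ∣ℤ s → Represents (+ q₀) (+ p)

OddPrimeDivisor : ℤ → Set
OddPrimeDivisor n = ∃[ p ] (Prime p × 3 ℕ.≤ p × (+ p) ∣ℤ n)

EvenNormDescends : ℕ → Set
EvenNormDescends q₀ = ∀ r s → (+ 2) ∣ℤ nrm (+ q₀) r s → ¬ (+ 2) ∣ℤ s →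
  OddPrimeDivisor (nrm (+ q₀) r s) ⊎ Descent (+ q₀) r s

module _ {q₀ : ℕ} (2≤q₀ : 2 ℕ.≤ q₀)
         (represent : RepresentsOddPrimeDivisors q₀) (even : EvenNormDescends q₀) where
  private
    q = + q₀

  module _ {r s : ℤ} where

    descent-common-prime : ∀ {p} → Prime p → (+ p) ∣ℤ nrm q r s → (+ p) ∣ℤ s → Descent q r s
    descent-common-prime p-prime p∣N p∣s = descent-common-factor (prime⇒2≤ p-prime)
      (prime-∣-square r p-prime (∣m+n∣n⇒∣m p∣N (∣n⇒∣m*n q (∣n⇒∣m*n s p∣s)))) p∣s

    descent-odd-prime : OddPrimeDivisor (nrm q r s) → Descent q r s
    descent-odd-prime (p , p-prime , 3≤p , p∣N) = by-cases ((+ p) ∣? s)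
      where
      from-divisible : ∀ {u} → ∃[ v′ ] (Norm≡p∨2p q (+ p) u v′ × (+ p) ∣ℤ conjMulRe q r s u v′ ×
                                         (+ p) ∣ℤ conjMulIm q r s u v′) → Descent q r s
      from-divisible (v′ , N≡p∨2p , p∣X , p∣Y) = descent-prime-norm 2≤q₀ {r} {s} p-prime 3≤p N≡p∨2p p∣X p∣Y
      from-representation : ¬ (+ p) ∣ℤ s → Represents q (+ p) → Descent q r s
      from-representation p∤s (u , v , N≡p∨2p) =
        from-divisible (conjMul-divisible {q} {p} {r} {s} p-prime 3≤p p∣N p∤s N≡p∨2p)
      by-cases : Dec ((+ p) ∣ℤ s) → Descent q r s
      by-cases (yes p∣s) = descent-common-prime p-prime p∣N p∣s
      by-cases (no p∤s) = from-representation p∤s (represent r s p-prime 3≤p p∣N p∤s)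

    descent-prime : ∀ {p} → Prime p → (+ p) ∣ℤ nrm q r s → Descent q r s
    descent-prime {p} p-prime p∣N = by-cases ((+ p) ∣? s) (ℕₚ.m≤n⇒m<n∨m≡n (prime⇒2≤ p-prime))
      where
      by-cases : Dec ((+ p) ∣ℤ s) → 2 ℕ.< p ⊎ 2 ≡ p → Descent q r s
      by-cases (yes p∣s) _ = descent-common-prime p-prime p∣N p∣s
      by-cases (no p∤s) (inj₁ 3≤p) = descent-odd-prime (p , p-prime , 3≤p , p∣N)
      by-cases (no p∤s) (inj₂ 2≡p) = [ descent-odd-prime , id ]′
        (even r s (subst (λ k → (+ k) ∣ℤ nrm q r s) (sym 2≡p) p∣N) (λ 2∣s → p∤s (subst (λ k → (+ k) ∣ℤ s) 2≡p 2∣s)))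

  descent : ∀ r s → s ≢ 0ℤ → Descent q r s
  descent r s s≢0 = from-prime (prime-divisor ∣ nrm q r s ∣ (ℕₚ.≤-trans 2≤q₀ (q₀≤∣nrm∣ q₀ r s s≢0)))
    where
    from-prime : ∃[ p ] (Prime p × p ℕ∣.∣ ∣ nrm q r s ∣) → Descent q r s
    from-prime (p , p-prime , p∣∣N∣) = descent-prime p-prime (∣ᵤ⇒∣ p∣∣N∣)

-- Thue's lemma

⌊√⌋-bracket : ∀ n → ∃[ k ] (k ℕ.* k ℕ.≤ n × n ℕ.< suc k ℕ.* suc k)
⌊√⌋-bracket zero = 0 , z≤n , s≤s z≤n
⌊√⌋-bracket (suc n) with ⌊√⌋-bracket n
... | k , k²≤n , n<[1+k]² with suc n ℕ.<? suc k ℕ.* suc k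
...   | yes 1+n<[1+k]² = k , ℕₚ.m≤n⇒m≤1+n k²≤n , 1+n<[1+k]²
...   | no 1+n≮[1+k]² = suc k , ℕₚ.≮⇒≥ 1+n≮[1+k]² ,
        ℕₚ.≤-<-trans n<[1+k]² (ℕₚ.*-mono-< (ℕₚ.n<1+n (suc k)) (ℕₚ.n<1+n (suc k)))

pigeonhole² : ∀ {m n} → n ℕ.< m ℕ.* m → (f : Fin m → Fin m → Fin n) →
              ∃[ a ] ∃[ b ] ∃[ a′ ] ∃[ b′ ] (¬ (a ≡ a′ × b ≡ b′) × f a b ≡ f a′ b′)
pigeonhole² {m} n<m² f = from-collision (Finₚ.pigeonhole n<m² (λ i → uncurry f (split i)))
  where
  split : Fin (m ℕ.* m) → Fin m × Fin m
  split = remQuot {m} m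
  from-collision : ∃[ i ] ∃[ j ] (i Fin.< j × uncurry f (split i) ≡ uncurry f (split j)) →
                   ∃[ a ] ∃[ b ] ∃[ a′ ] ∃[ b′ ] (¬ (a ≡ a′ × b ≡ b′) × f a b ≡ f a′ b′)
  from-collision (i , j , i<j , fᵢ≡fⱼ) =
    proj₁ (split i) , proj₂ (split i) , proj₁ (split j) , proj₂ (split j) , distinct , fᵢ≡fⱼ
    where
    distinct : ¬ (proj₁ (split i) ≡ proj₁ (split j) × proj₂ (split i) ≡ proj₂ (split j))
    distinct (a≡a′ , b≡b′) = Finₚ.<⇒≢ i<j (begin
      i                           ≡⟨ Finₚ.combine-remQuot {m} m i ⟨
      uncurry combine (split i)   ≡⟨ cong₂ combine a≡a′ b≡b′ ⟩
      uncurry combine (split j)   ≡⟨ Finₚ.combine-remQuot {m} m j ⟩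
      j                           ∎)

%ℕ-≡⇒∣- : ∀ x y p .{{_ : ℕ.NonZero p}} → x %ℕ p ≡ y %ℕ p → (+ p) ∣ℤ x - y
%ℕ-≡⇒∣- x y p x%p≡y%p = divides (x /ℕ p - y /ℕ p) (begin
  x - y
    ≡⟨ cong₂ _-_ (a≡a%ℕn+[a/ℕn]*n x p) (a≡a%ℕn+[a/ℕn]*n y p) ⟩
  (+ (x %ℕ p) + x /ℕ p * + p) - (+ (y %ℕ p) + y /ℕ p * + p)
    ≡⟨ cong (λ t → (+ (x %ℕ p) + x /ℕ p * + p) - (+ t + y /ℕ p * + p)) (sym x%p≡y%p) ⟩
  (+ (x %ℕ p) + x /ℕ p * + p) - (+ (x %ℕ p) + y /ℕ p * + p)
    ≡⟨ cancel (+ (x %ℕ p)) (x /ℕ p) (y /ℕ p) (+ p) ⟩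
  (x /ℕ p - y /ℕ p) * + p
    ∎)
  where
  cancel : ∀ m a b P → (m + a * P) - (m + b * P) ≡ (a - b) * P
  cancel m a b P = solve (m ∷ a ∷ b ∷ P ∷ [])

SmallSolution : ℕ → ℤ → ℤ → Set
SmallSolution p r s = ∃[ x ] ∃[ y ]
  ((+ p) ∣ℤ s * x - r * y × ¬ (x ≡ 0ℤ × y ≡ 0ℤ) × ∣ x ∣ ℕ.* ∣ x ∣ ℕ.< p × ∣ y ∣ ℕ.* ∣ y ∣ ℕ.< p)

∣-∣≤ : ∀ {k} (i j : Fin (suc k)) → ∣ + toℕ i - + toℕ j ∣ ℕ.≤ k
∣-∣≤ {k} i j = subst (ℕ._≤ k) (sym (cong ∣_∣ (ℤₚ.m-n≡m⊖n (toℕ i) (toℕ j))))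
  (ℕₚ.≤-trans (ℤₚ.∣m⊝n∣≤m⊔n (toℕ i) (toℕ j)) (ℕₚ.⊔-lub (Finₚ.toℕ≤pred[n] i) (Finₚ.toℕ≤pred[n] j)))

thue-below : ∀ {p} r s k → .{{ℕ.NonZero p}} → k ℕ.* k ℕ.< p → p ℕ.< suc k ℕ.* suc k → SmallSolution p r s
thue-below {p} r s k k²<p p<[1+k]² = from-collision (pigeonhole² p<[1+k]² residue)
  where
  value : Fin (suc k) → Fin (suc k) → ℤ
  value a b = s * + toℕ a - r * + toℕ b
  residue : Fin (suc k) → Fin (suc k) → Fin p
  residue a b = fromℕ< (n%ℕd<d (value a b) p)
  small : ∀ (i j : Fin (suc k)) → ∣ + toℕ i - + toℕ j ∣ ℕ.* ∣ + toℕ i - + toℕ j ∣ ℕ.< p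
  small i j = ℕₚ.≤-<-trans (ℕₚ.*-mono-≤ (∣-∣≤ i j) (∣-∣≤ i j)) k²<p
  from-collision : ∃[ a ] ∃[ b ] ∃[ a′ ] ∃[ b′ ] (¬ (a ≡ a′ × b ≡ b′) × residue a b ≡ residue a′ b′) →
                   SmallSolution p r s
  from-collision (a , b , a′ , b′ , distinct , residue≡) =
    x , y , subst ((+ p) ∣ℤ_) value-diff p∣value-diff , nonzero , small a a′ , small b b′
    where
    x = + toℕ a - + toℕ a′
    y = + toℕ b - + toℕ b′
    value-diff : value a b - value a′ b′ ≡ s * x - r * y
    value-diff = difference (+ toℕ a) (+ toℕ b) (+ toℕ a′) (+ toℕ b′)
      where
      difference : ∀ A B A′ B′ → (s * A - r * B) - (s * A′ - r * B′) ≡ s * (A - A′) - r * (B - B′)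
      difference A B A′ B′ = solve (s ∷ r ∷ A ∷ B ∷ A′ ∷ B′ ∷ [])
    p∣value-diff : (+ p) ∣ℤ value a b - value a′ b′
    p∣value-diff = %ℕ-≡⇒∣- (value a b) (value a′ b′) p
      (trans (sym (Finₚ.toℕ-fromℕ< _)) (trans (cong toℕ residue≡) (Finₚ.toℕ-fromℕ< _)))
    nonzero : ¬ (x ≡ 0ℤ × y ≡ 0ℤ)
    nonzero (x≡0 , y≡0) = distinct (same x≡0 , same y≡0)
      where
      same : ∀ {i j : Fin (suc k)} → + toℕ i - + toℕ j ≡ 0ℤ → i ≡ j
      same i-j≡0 = Finₚ.toℕ-injective (ℤₚ.+-injective (ℤₚ.i-j≡0⇒i≡j _ _ i-j≡0))

thue : ∀ {p} r s → Prime p → SmallSolution p r s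
thue {p} r s p-prime with ⌊√⌋-bracket p
... | k , k²≤p , p<[1+k]² = thue-below r s k {{prime⇒nonZero p-prime}} k²<p p<[1+k]²
  where
  k²<p : k ℕ.* k ℕ.< p
  k²<p = ℕₚ.≤∧≢⇒< k²≤p (λ k²≡p → prime≢square p-prime k (sym k²≡p))

-- s²N(x, y) = (sx - ry)(sx + ry) + y²N(r, s).
thue-divides-nrm : ∀ {q p r s x y} → Prime p → (+ p) ∣ℤ nrm q r s → ¬ (+ p) ∣ℤ s →
                   (+ p) ∣ℤ s * x - r * y → (+ p) ∣ℤ nrm q x y
thue-divides-nrm {q} {p} {r} {s} {x} {y} p-prime p∣N p∤s p∣sx-ry =
  prime-∣-*ʳ p-prime p∤s (prime-∣-*ʳ p-prime p∤s (subst ((+ p) ∣ℤ_) (sym s²N≡)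
    (∣m∣n⇒∣m+n (∣m⇒∣m*n (s * x + r * y) p∣sx-ry) (∣n⇒∣m*n (y * y) p∣N))))
  where
  s²N≡ : s * (s * (x * x + q * (y * y))) ≡ (s * x - r * y) * (s * x + r * y) + y * y * (r * r + q * (s * s))
  s²N≡ = solve (q ∷ r ∷ s ∷ x ∷ y ∷ [])

x²+qy²≡0⇒ : ∀ {q₀} x y → 1 ℕ.≤ q₀ → ∣ x ∣ ℕ.* ∣ x ∣ ℕ.+ q₀ ℕ.* (∣ y ∣ ℕ.* ∣ y ∣) ≡ 0 → x ≡ 0ℤ × y ≡ 0ℤ
x²+qy²≡0⇒ {q₀} x y 1≤q₀ N≡0 = square≡0 x (ℕₚ.m+n≡0⇒m≡0 _ N≡0) , square≡0 y y²≡0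
  where
  square≡0 : ∀ z → ∣ z ∣ ℕ.* ∣ z ∣ ≡ 0 → z ≡ 0ℤ
  square≡0 z z²≡0 = [ ℤₚ.∣i∣≡0⇒i≡0 , ℤₚ.∣i∣≡0⇒i≡0 ]′ (ℕₚ.m*n≡0⇒m≡0∨n≡0 ∣ z ∣ z²≡0)
  y²≡0 : ∣ y ∣ ℕ.* ∣ y ∣ ≡ 0
  y²≡0 = [ (λ q₀≡0 → contradiction (sym q₀≡0) (ℕₚ.<⇒≢ 1≤q₀)) , id ]′
           (ℕₚ.m*n≡0⇒m≡0∨n≡0 q₀ (ℕₚ.m+n≡0⇒n≡0 (∣ x ∣ ℕ.* ∣ x ∣) N≡0))

-- 0 < N(x, y) < (1 + q)p.
small-multiple : ∀ {q₀ p} x y → 1 ℕ.≤ q₀ → ¬ (x ≡ 0ℤ × y ≡ 0ℤ) → ∣ x ∣ ℕ.* ∣ x ∣ ℕ.< p → ∣ y ∣ ℕ.* ∣ y ∣ ℕ.< p →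
                 (+ p) ∣ℤ nrm (+ q₀) x y → ∃[ k ] (1 ℕ.≤ k × k ℕ.≤ q₀ × nrm (+ q₀) x y ≡ + k * + p)
small-multiple {q₀} {p} x y 1≤q₀ nonzero x²<p y²<p p∣N =
  from-quotient (subst (p ℕ∣.∣_) (cong ∣_∣ (nrm≡+ q₀ x y)) (∣⇒∣ᵤ p∣N))
  where
  M = ∣ x ∣ ℕ.* ∣ x ∣ ℕ.+ q₀ ℕ.* (∣ y ∣ ℕ.* ∣ y ∣)
  M<[1+q₀]p : M ℕ.< suc q₀ ℕ.* p
  M<[1+q₀]p = ℕₚ.+-mono-<-≤ x²<p (ℕₚ.*-monoʳ-≤ q₀ (ℕₚ.<⇒≤ y²<p))
  from-quotient : p ℕ∣.∣ M → ∃[ k ] (1 ℕ.≤ k × k ℕ.≤ q₀ × nrm (+ q₀) x y ≡ + k * + p)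
  from-quotient (ℕ∣.divides k M≡kp) =
    k , 1≤k , k≤q₀ , trans (nrm≡+ q₀ x y) (trans (cong +_ M≡kp) (ℤₚ.pos-* k p))
    where
    1≤k : 1 ℕ.≤ k
    1≤k = ℕₚ.n≢0⇒n>0 (λ { refl → nonzero (x²+qy²≡0⇒ x y 1≤q₀ M≡kp) })
    k≤q₀ : k ℕ.≤ q₀
    k≤q₀ = ℕₚ.≤-pred (ℕₚ.*-cancelʳ-< p k (suc q₀) (subst (ℕ._< suc q₀ ℕ.* p) M≡kp M<[1+q₀]p))

SmallMultiplesReduce : ℕ → Set
SmallMultiplesReduce q₀ = ∀ {p} x y k → Prime p → 1 ℕ.≤ k → k ℕ.≤ q₀ →
  nrm (+ q₀) x y ≡ + k * + p → Represents (+ q₀) (+ p)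

represents-odd-prime-divisors : ∀ {q₀} → 1 ℕ.≤ q₀ → SmallMultiplesReduce q₀ → RepresentsOddPrimeDivisors q₀
represents-odd-prime-divisors {q₀} 1≤q₀ reduce {p} r s p-prime _ p∣N p∤s = from-thue (thue r s p-prime)
  where
  from-multiple : ∀ {x y} → ∃[ k ] (1 ℕ.≤ k × k ℕ.≤ q₀ × nrm (+ q₀) x y ≡ + k * + p) → Represents (+ q₀) (+ p)
  from-multiple {x} {y} (k , 1≤k , k≤q₀ , N≡kp) = reduce x y k p-prime 1≤k k≤q₀ N≡kp
  from-thue : SmallSolution p r s → Represents (+ q₀) (+ p)
  from-thue (x , y , p∣sx-ry , nonzero , x²<p , y²<p) =
    from-multiple {x} {y} (small-multiple x y 1≤q₀ nonzero x²<p y²<p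
      (thue-divides-nrm {+ q₀} {p} {r} {s} p-prime p∣N p∤s p∣sx-ry))

-- From kp to p or 2p

represent-P : ∀ {q P} x y → nrm q x y ≡ 1ℤ * P → Represents q P
represent-P {P = P} x y N≡P = x , y , norm≡p (trans N≡P (ℤₚ.*-identityˡ P))

represent-2P : ∀ {q P} x y → nrm q x y ≡ + 2 * P → Represents q P
represent-2P x y N≡2P = x , y , norm≡2p N≡2P

prime[3] : Prime 3
prime[3] = from-yes (prime? 3)

prime[5] : Prime 5
prime[5] = from-yes (prime? 5)

2∣2* : ∀ x → (+ 2) ∣ℤ + 2 * x
2∣2* x = divides x (ℤₚ.*-comm (+ 2) x)

2∤3 : ¬ (+ 2) ∣ℤ + 3
2∤3 = from-no ((+ 2) ∣? (+ 3))

3∤2 : ¬ (+ 3) ∣ℤ + 2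
3∤2 = from-no ((+ 3) ∣? (+ 2))

x≡x-y+y : ∀ x y → x ≡ (x - y) + y
x≡x-y+y x y = solve (x ∷ y ∷ [])

+-≡-neg : ∀ x y → x + y ≡ x - (- y)
+-≡-neg x y = cong (_+_ x) (sym (ℤₚ.neg-involutive y))

represent-halves : ∀ q x y P → (+ 2) ∣ℤ x → (+ 2) ∣ℤ y → nrm q x y ≡ + 4 * P → Represents q P
represent-halves q x y P (divides a x≡2a) (divides w y≡2w) N≡4P =
  a , w , norm≡p (ℤₚ.*-cancelˡ-≡ (+ 4) (a * a + q * (w * w)) P (begin
    + 4 * (a * a + q * (w * w))                          ≡⟨ solve (q ∷ a ∷ w ∷ []) ⟩
    (a * + 2) * (a * + 2) + q * ((w * + 2) * (w * + 2))  ≡⟨ cong₂ (λ x y → x * x + q * (y * y)) x≡2a y≡2w ⟨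
    x * x + q * (y * y)                                  ≡⟨ N≡4P ⟩
    + 4 * P                                              ∎))

-- x² = ℓ(P - y²), so x = ℓt and y² + ℓt² = P.
represent-ℓP : ∀ {ℓ} → Prime ℓ → ∀ x y P → nrm (+ ℓ) x y ≡ + ℓ * P → Represents (+ ℓ) P
represent-ℓP {ℓ} ℓ-prime x y P N≡ℓP = from-ℓ∣x (prime-∣-square x ℓ-prime (divides (P - y * y) x²≡))
  where
  x²≡ : x * x ≡ (P - y * y) * + ℓ
  x²≡ = begin
    x * x                                     ≡⟨ split (+ ℓ) ⟩
    (x * x + + ℓ * (y * y)) - + ℓ * (y * y)   ≡⟨ cong (_- + ℓ * (y * y)) N≡ℓP ⟩
    + ℓ * P - + ℓ * (y * y)                   ≡⟨ factor (+ ℓ) ⟩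
    (P - y * y) * + ℓ                         ∎
    where
    split : ∀ Q → x * x ≡ (x * x + Q * (y * y)) - Q * (y * y)
    split Q = solve (x ∷ y ∷ Q ∷ [])
    factor : ∀ Q → Q * P - Q * (y * y) ≡ (P - y * y) * Q
    factor Q = solve (y ∷ P ∷ Q ∷ [])
  from-ℓ∣x : (+ ℓ) ∣ℤ x → Represents (+ ℓ) P
  from-ℓ∣x (divides t x≡ℓt) =
    y , t , norm≡p (ℤₚ.*-cancelˡ-≡ (+ ℓ) (y * y + + ℓ * (t * t)) P {{prime⇒nonZero ℓ-prime}} (begin
      + ℓ * (y * y + + ℓ * (t * t))             ≡⟨ expand (+ ℓ) ⟩
      (t * + ℓ) * (t * + ℓ) + + ℓ * (y * y)     ≡⟨ cong (λ z → z * z + + ℓ * (y * y)) x≡ℓt ⟨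
      x * x + + ℓ * (y * y)                     ≡⟨ N≡ℓP ⟩
      + ℓ * P                                   ∎))
    where
    expand : ∀ Q → Q * (y * y + Q * (t * t)) ≡ (t * Q) * (t * Q) + Q * (y * y)
    expand Q = solve (y ∷ t ∷ Q ∷ [])

-- From x = 3t + y: 9 N(t + 2y, t) = 6 N(x, y) = 18 P.
represent₅-3P-shifted : ∀ x y P → nrm (+ 5) x y ≡ + 3 * P → (+ 3) ∣ℤ x - y → Represents (+ 5) P
represent₅-3P-shifted x y P N≡3P (divides t x-y≡3t) =
  t + + 2 * y , t , norm≡2p (ℤₚ.*-cancelˡ-≡ (+ 9) ((t + + 2 * y) * (t + + 2 * y) + + 5 * (t * t)) (+ 2 * P) (begin
    + 9 * ((t + + 2 * y) * (t + + 2 * y) + + 5 * (t * t))  ≡⟨ solve (t ∷ y ∷ []) ⟩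
    + 6 * ((t * + 3 + y) * (t * + 3 + y) + + 5 * (y * y))  ≡⟨ cong (λ z → + 6 * (z * z + + 5 * (y * y))) x≡3t+y ⟨
    + 6 * (x * x + + 5 * (y * y))                          ≡⟨ cong (+ 6 *_) N≡3P ⟩
    + 6 * (+ 3 * P)                                        ≡⟨ solve (P ∷ []) ⟩
    + 9 * (+ 2 * P)                                        ∎))
  where
  x≡3t+y : x ≡ t * + 3 + y
  x≡3t+y = trans (x≡x-y+y x y) (cong (_+ y) x-y≡3t)

-- (x - y)(x + y) = 3(P - 2y²).
represent₅-3P : ∀ x y P → nrm (+ 5) x y ≡ + 3 * P → Represents (+ 5) P
represent₅-3P x y P N≡3P =
  [ represent₅-3P-shifted x y P N≡3P
  , (λ 3∣x+y → represent₅-3P-shifted x (- y) P (trans (nrm-neg (+ 5) x y) N≡3P) (subst ((+ 3) ∣ℤ_) (+-≡-neg x y) 3∣x+y))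
  ]′ (prime-∣-* (x - y) (x + y) prime[3] (divides (P - + 2 * (y * y)) product≡))
  where
  product≡ : (x - y) * (x + y) ≡ (P - + 2 * (y * y)) * + 3
  product≡ = begin
    (x - y) * (x + y)                         ≡⟨ solve (x ∷ y ∷ []) ⟩
    (x * x + + 5 * (y * y)) - + 6 * (y * y)   ≡⟨ cong (_- + 6 * (y * y)) N≡3P ⟩
    + 3 * P - + 6 * (y * y)                   ≡⟨ solve (y ∷ P ∷ []) ⟩
    (P - + 2 * (y * y)) * + 3                 ∎

-- (x - y)(x + y) = 2(2P - 3y²) makes x - y = 2T even; then 3y² = 2(P - T² - Ty),
-- so y and hence x are even.
represent₅-4P : ∀ x y P → nrm (+ 5) x y ≡ + 4 * P → Represents (+ 5) P
represent₅-4P x y P N≡4P = from-2∣x-y 2∣x-y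
  where
  product≡ : (x - y) * (x + y) ≡ (+ 2 * P - + 3 * (y * y)) * + 2
  product≡ = begin
    (x - y) * (x + y)                         ≡⟨ solve (x ∷ y ∷ []) ⟩
    (x * x + + 5 * (y * y)) - + 6 * (y * y)   ≡⟨ cong (_- + 6 * (y * y)) N≡4P ⟩
    + 4 * P - + 6 * (y * y)                   ≡⟨ solve (y ∷ P ∷ []) ⟩
    (+ 2 * P - + 3 * (y * y)) * + 2           ∎
  x+y-2y≡x-y : (x + y) - + 2 * y ≡ x - y
  x+y-2y≡x-y = solve (x ∷ y ∷ [])
  2∣x-y : (+ 2) ∣ℤ x - y
  2∣x-y = [ id , (λ 2∣x+y → subst ((+ 2) ∣ℤ_) x+y-2y≡x-y (∣m∣n⇒∣m-n 2∣x+y (2∣2* y))) ]′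
    (prime-∣-* (x - y) (x + y) prime[2] (divides (+ 2 * P - + 3 * (y * y)) product≡))
  from-2∣x-y : (+ 2) ∣ℤ x - y → Represents (+ 5) P
  from-2∣x-y 2∣x-y@(divides T x-y≡2T) = represent-halves (+ 5) x y P 2∣x 2∣y N≡4P
    where
    x≡2T+y : x ≡ T * + 2 + y
    x≡2T+y = trans (x≡x-y+y x y) (cong (_+ y) x-y≡2T)
    3y²≡ : + 3 * (y * y) ≡ (P - T * T - T * y) * + 2
    3y²≡ = ℤₚ.*-cancelˡ-≡ (+ 2) (+ 3 * (y * y)) ((P - T * T - T * y) * + 2) (begin
      + 2 * (+ 3 * (y * y))
        ≡⟨ solve (T ∷ y ∷ []) ⟩
      ((T * + 2 + y) * (T * + 2 + y) + + 5 * (y * y)) - + 4 * (T * T + T * y)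
        ≡⟨ cong (λ z → (z * z + + 5 * (y * y)) - + 4 * (T * T + T * y)) x≡2T+y ⟨
      (x * x + + 5 * (y * y)) - + 4 * (T * T + T * y)
        ≡⟨ cong (_- + 4 * (T * T + T * y)) N≡4P ⟩
      + 4 * P - + 4 * (T * T + T * y)
        ≡⟨ solve (P ∷ T ∷ y ∷ []) ⟩
      + 2 * ((P - T * T - T * y) * + 2)
        ∎)
    2∣y : (+ 2) ∣ℤ y
    2∣y = prime-∣-square y prime[2] (prime-∣-*ʳ prime[2] 2∤3 (divides (P - T * T - T * y) 3y²≡))
    2∣x : (+ 2) ∣ℤ x
    2∣x = subst ((+ 2) ∣ℤ_) (sym (x≡x-y+y x y)) (∣m∣n⇒∣m+n 2∣x-y 2∣y)

-- x² = 3(P - 2y²), so x = 3t and 3 N(2y, t) = 2 N(x, y) = 6P.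
represent₆-3P : ∀ x y P → nrm (+ 6) x y ≡ + 3 * P → Represents (+ 6) P
represent₆-3P x y P N≡3P = from-3∣x (prime-∣-square x prime[3] (divides (P - + 2 * (y * y)) x²≡))
  where
  x²≡ : x * x ≡ (P - + 2 * (y * y)) * + 3
  x²≡ = begin
    x * x                                     ≡⟨ solve (x ∷ y ∷ []) ⟩
    (x * x + + 6 * (y * y)) - + 6 * (y * y)   ≡⟨ cong (_- + 6 * (y * y)) N≡3P ⟩
    + 3 * P - + 6 * (y * y)                   ≡⟨ solve (y ∷ P ∷ []) ⟩
    (P - + 2 * (y * y)) * + 3                 ∎
  from-3∣x : (+ 3) ∣ℤ x → Represents (+ 6) P
  from-3∣x (divides t x≡3t) =
    + 2 * y , t , norm≡2p (ℤₚ.*-cancelˡ-≡ (+ 3) ((+ 2 * y) * (+ 2 * y) + + 6 * (t * t)) (+ 2 * P) (begin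
      + 3 * ((+ 2 * y) * (+ 2 * y) + + 6 * (t * t))  ≡⟨ solve (y ∷ t ∷ []) ⟩
      + 2 * ((t * + 3) * (t * + 3) + + 6 * (y * y))  ≡⟨ cong (λ z → + 2 * (z * z + + 6 * (y * y))) x≡3t ⟨
      + 2 * (x * x + + 6 * (y * y))                  ≡⟨ cong (+ 2 *_) N≡3P ⟩
      + 2 * (+ 3 * P)                                ≡⟨ solve (P ∷ []) ⟩
      + 3 * (+ 2 * P)                                ∎))

-- x² = 2(2P - 3y²), so x = 2t; then 3y² = 2(P - t²) makes y even too.
represent₆-4P : ∀ x y P → nrm (+ 6) x y ≡ + 4 * P → Represents (+ 6) P
represent₆-4P x y P N≡4P = from-2∣x (prime-∣-square x prime[2] (divides (+ 2 * P - + 3 * (y * y)) x²≡))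
  where
  x²≡ : x * x ≡ (+ 2 * P - + 3 * (y * y)) * + 2
  x²≡ = begin
    x * x                                     ≡⟨ solve (x ∷ y ∷ []) ⟩
    (x * x + + 6 * (y * y)) - + 6 * (y * y)   ≡⟨ cong (_- + 6 * (y * y)) N≡4P ⟩
    + 4 * P - + 6 * (y * y)                   ≡⟨ solve (y ∷ P ∷ []) ⟩
    (+ 2 * P - + 3 * (y * y)) * + 2           ∎
  from-2∣x : (+ 2) ∣ℤ x → Represents (+ 6) P
  from-2∣x 2∣x@(divides t x≡2t) = represent-halves (+ 6) x y P 2∣x 2∣y N≡4P
    where
    3y²≡ : + 3 * (y * y) ≡ (P - t * t) * + 2
    3y²≡ = ℤₚ.*-cancelˡ-≡ (+ 2) (+ 3 * (y * y)) ((P - t * t) * + 2) (begin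
      + 2 * (+ 3 * (y * y))                                         ≡⟨ solve (t ∷ y ∷ []) ⟩
      ((t * + 2) * (t * + 2) + + 6 * (y * y)) - + 4 * (t * t)       ≡⟨ cong (λ z → (z * z + + 6 * (y * y)) - + 4 * (t * t)) x≡2t ⟨
      (x * x + + 6 * (y * y)) - + 4 * (t * t)                       ≡⟨ cong (_- + 4 * (t * t)) N≡4P ⟩
      + 4 * P - + 4 * (t * t)                                       ≡⟨ solve (P ∷ t ∷ []) ⟩
      + 2 * ((P - t * t) * + 2)                                     ∎)
    2∣y : (+ 2) ∣ℤ y
    2∣y = prime-∣-square y prime[2] (prime-∣-*ʳ prime[2] 2∤3 (divides (P - t * t) 3y²≡))

-- From x = 5t + 2y: 25 N(2t + 2y, t) = 10 N(x, y) = 50 P.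
represent₆-5P-shifted : ∀ x y P → nrm (+ 6) x y ≡ + 5 * P → (+ 5) ∣ℤ x - + 2 * y → Represents (+ 6) P
represent₆-5P-shifted x y P N≡5P (divides t x-2y≡5t) =
  + 2 * t + + 2 * y , t ,
  norm≡2p (ℤₚ.*-cancelˡ-≡ (+ 25) ((+ 2 * t + + 2 * y) * (+ 2 * t + + 2 * y) + + 6 * (t * t)) (+ 2 * P) (begin
    + 25 * ((+ 2 * t + + 2 * y) * (+ 2 * t + + 2 * y) + + 6 * (t * t))
      ≡⟨ solve (t ∷ y ∷ []) ⟩
    + 10 * ((t * + 5 + + 2 * y) * (t * + 5 + + 2 * y) + + 6 * (y * y))
      ≡⟨ cong (λ z → + 10 * (z * z + + 6 * (y * y))) x≡5t+2y ⟨
    + 10 * (x * x + + 6 * (y * y))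
      ≡⟨ cong (+ 10 *_) N≡5P ⟩
    + 10 * (+ 5 * P)
      ≡⟨ solve (P ∷ []) ⟩
    + 25 * (+ 2 * P)
      ∎))
  where
  x≡5t+2y : x ≡ t * + 5 + + 2 * y
  x≡5t+2y = trans (x≡x-y+y x (+ 2 * y)) (cong (_+ + 2 * y) x-2y≡5t)

-- (x - 2y)(x + 2y) = 5(P - 2y²).
represent₆-5P : ∀ x y P → nrm (+ 6) x y ≡ + 5 * P → Represents (+ 6) P
represent₆-5P x y P N≡5P =
  [ represent₆-5P-shifted x y P N≡5P
  , (λ 5∣x+2y → represent₆-5P-shifted x (- y) P (trans (nrm-neg (+ 6) x y) N≡5P)
                  (subst ((+ 5) ∣ℤ_) x+2y≡x-2[-y] 5∣x+2y))
  ]′ (prime-∣-* (x - + 2 * y) (x + + 2 * y) prime[5] (divides (P - + 2 * (y * y)) product≡))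
  where
  x+2y≡x-2[-y] : x + + 2 * y ≡ x - + 2 * (- y)
  x+2y≡x-2[-y] = solve (x ∷ y ∷ [])
  product≡ : (x - + 2 * y) * (x + + 2 * y) ≡ (P - + 2 * (y * y)) * + 5
  product≡ = begin
    (x - + 2 * y) * (x + + 2 * y)              ≡⟨ solve (x ∷ y ∷ []) ⟩
    (x * x + + 6 * (y * y)) - + 10 * (y * y)   ≡⟨ cong (_- + 10 * (y * y)) N≡5P ⟩
    + 5 * P - + 10 * (y * y)                   ≡⟨ solve (y ∷ P ∷ []) ⟩
    (P - + 2 * (y * y)) * + 5                  ∎

-- x² = 6(P - y²): x = 2a with 2a² = 3(P - y²), so a = 3t and y² + 6t² = P.
represent₆-6P : ∀ x y P → nrm (+ 6) x y ≡ + 6 * P → Represents (+ 6) P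
represent₆-6P x y P N≡6P = from-2∣x (prime-∣-square x prime[2] (divides (+ 3 * (P - y * y)) x²≡))
  where
  x²≡ : x * x ≡ (+ 3 * (P - y * y)) * + 2
  x²≡ = begin
    x * x                                     ≡⟨ solve (x ∷ y ∷ []) ⟩
    (x * x + + 6 * (y * y)) - + 6 * (y * y)   ≡⟨ cong (_- + 6 * (y * y)) N≡6P ⟩
    + 6 * P - + 6 * (y * y)                   ≡⟨ solve (y ∷ P ∷ []) ⟩
    (+ 3 * (P - y * y)) * + 2                 ∎
  from-2∣x : (+ 2) ∣ℤ x → Represents (+ 6) P
  from-2∣x (divides a x≡2a) = from-3∣a (prime-∣-square a prime[3] (prime-∣-*ʳ prime[3] 3∤2 (divides (P - y * y) 2a²≡)))
    where
    2a²≡ : + 2 * (a * a) ≡ (P - y * y) * + 3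
    2a²≡ = ℤₚ.*-cancelˡ-≡ (+ 2) (+ 2 * (a * a)) ((P - y * y) * + 3) (begin
      + 2 * (+ 2 * (a * a))          ≡⟨ solve (a ∷ []) ⟩
      (a * + 2) * (a * + 2)          ≡⟨ cong (λ z → z * z) x≡2a ⟨
      x * x                          ≡⟨ x²≡ ⟩
      (+ 3 * (P - y * y)) * + 2      ≡⟨ solve (y ∷ P ∷ []) ⟩
      + 2 * ((P - y * y) * + 3)      ∎)
    from-3∣a : (+ 3) ∣ℤ a → Represents (+ 6) P
    from-3∣a (divides t a≡3t) = y , t , norm≡p (ℤₚ.*-cancelˡ-≡ (+ 6) (y * y + + 6 * (t * t)) P (begin
      + 6 * (y * y + + 6 * (t * t))                          ≡⟨ solve (y ∷ t ∷ []) ⟩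
      ((t * + 3) * + 2) * ((t * + 3) * + 2) + + 6 * (y * y)  ≡⟨ cong (λ z → (z * + 2) * (z * + 2) + + 6 * (y * y)) a≡3t ⟨
      (a * + 2) * (a * + 2) + + 6 * (y * y)                  ≡⟨ cong (λ z → z * z + + 6 * (y * y)) x≡2a ⟨
      x * x + + 6 * (y * y)                                  ≡⟨ N≡6P ⟩
      + 6 * P                                                ∎))

multiples-reduce₂ : SmallMultiplesReduce 2
multiples-reduce₂ x y 1 _ _ _ N≡p = represent-P x y N≡p
multiples-reduce₂ x y 2 _ _ _ N≡2p = represent-2P x y N≡2p
multiples-reduce₂ _ _ (suc (suc (suc _))) _ _ (s≤s (s≤s ())) _

multiples-reduce₃ : SmallMultiplesReduce 3
multiples-reduce₃ x y 1 _ _ _ N≡p = represent-P x y N≡p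
multiples-reduce₃ x y 2 _ _ _ N≡2p = represent-2P x y N≡2p
multiples-reduce₃ {p} x y 3 _ _ _ N≡3p = represent-ℓP prime[3] x y (+ p) N≡3p
multiples-reduce₃ _ _ (suc (suc (suc (suc _)))) _ _ (s≤s (s≤s (s≤s ()))) _

multiples-reduce₅ : SmallMultiplesReduce 5
multiples-reduce₅ x y 1 _ _ _ N≡p = represent-P x y N≡p
multiples-reduce₅ x y 2 _ _ _ N≡2p = represent-2P x y N≡2p
multiples-reduce₅ {p} x y 3 _ _ _ N≡3p = represent₅-3P x y (+ p) N≡3p
multiples-reduce₅ {p} x y 4 _ _ _ N≡4p = represent₅-4P x y (+ p) N≡4p
multiples-reduce₅ {p} x y 5 _ _ _ N≡5p = represent-ℓP prime[5] x y (+ p) N≡5p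
multiples-reduce₅ _ _ (suc (suc (suc (suc (suc (suc _)))))) _ _ (s≤s (s≤s (s≤s (s≤s (s≤s ()))))) _

multiples-reduce₆ : SmallMultiplesReduce 6
multiples-reduce₆ x y 1 _ _ _ N≡p = represent-P x y N≡p
multiples-reduce₆ x y 2 _ _ _ N≡2p = represent-2P x y N≡2p
multiples-reduce₆ {p} x y 3 _ _ _ N≡3p = represent₆-3P x y (+ p) N≡3p
multiples-reduce₆ {p} x y 4 _ _ _ N≡4p = represent₆-4P x y (+ p) N≡4p
multiples-reduce₆ {p} x y 5 _ _ _ N≡5p = represent₆-5P x y (+ p) N≡5p
multiples-reduce₆ {p} x y 6 _ _ _ N≡6p = represent₆-6P x y (+ p) N≡6p
multiples-reduce₆ _ _ (suc (suc (suc (suc (suc (suc (suc _))))))) _ _ (s≤s (s≤s (s≤s (s≤s (s≤s (s≤s ())))))) _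

-- The prime 2

odd⇒≡2k+1 : ∀ x → ¬ (+ 2) ∣ℤ x → ∃[ k ] (x ≡ k * + 2 + 1ℤ)
odd⇒≡2k+1 x 2∤x = by-remainder (x %ℕ 2) (n%ℕd<d x 2) (a≡a%ℕn+[a/ℕn]*n x 2)
  where
  by-remainder : ∀ m → m ℕ.< 2 → x ≡ + m + (x /ℕ 2) * + 2 → ∃[ k ] (x ≡ k * + 2 + 1ℤ)
  by-remainder 0 _ x≡ = ⊥-elim (2∤x (divides (x /ℕ 2) (trans x≡ (ℤₚ.+-identityˡ _))))
  by-remainder 1 _ x≡ = x /ℕ 2 , trans x≡ (ℤₚ.+-comm 1ℤ ((x /ℕ 2) * + 2))
  by-remainder (suc (suc _)) (s≤s (s≤s ())) _

even-descends₂ : EvenNormDescends 2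
even-descends₂ r s 2∣N _ = inj₂ (halving (prime-∣-square r prime[2] (∣m+n∣n⇒∣m 2∣N (2∣2* (s * s)))))
  where
  halving : (+ 2) ∣ℤ r → Descent (+ 2) r s
  halving (divides a r≡2a) = record
    { u = 0ℤ ; v = 1ℤ ; d = + 2 ; r′ = s ; s′ = - a
    ; d≢0 = λ ()
    ; d*r′≡re = re
    ; d*s′≡im = im
    ; nrm[u,v]≢0 = λ ()
    ; ∣nrm[u,v]∣<∣d∣² = from-yes (2 ℕ.<? 4)
    ; generated-φ[u,v] =
        Generated-resp (Equiv-trans (negate-Equiv -[1+ 1 ] 0ℤ (+ 2)) (scaleT-Equiv {+ 2} idT (λ ()))) Generated-idT
    }
    where
    re : + 2 * s ≡ r * 0ℤ + + 2 * (s * 1ℤ)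
    re = solve (r ∷ s ∷ [])
    im : + 2 * (- a) ≡ s * 0ℤ - r * 1ℤ
    im = begin
      + 2 * (- a)               ≡⟨ solve (s ∷ a ∷ []) ⟩
      s * 0ℤ - (a * + 2) * 1ℤ   ≡⟨ cong (λ z → s * 0ℤ - z * 1ℤ) r≡2a ⟨
      s * 0ℤ - r * 1ℤ           ∎

descent₃ : ∀ {r s} ε m → ε * ε ≡ 1ℤ → r ≡ + 4 * m + ε * s → Generated (+ 3) (φ (+ 3) 1ℤ ε) → Descent (+ 3) r s
descent₃ {r} {s} ε m ε²≡1 r≡4m+εs generated = record
  { u = 1ℤ ; v = ε ; d = + 4 ; r′ = m + ε * s ; s′ = - (ε * m)
  ; d≢0 = λ ()
  ; d*r′≡re = re
  ; d*s′≡im = im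
  ; nrm[u,v]≢0 = λ N≡0 → ℤₚ.<⇒≢ (+<+ (s≤s z≤n)) (sym (trans (sym N≡4) N≡0))
  ; ∣nrm[u,v]∣<∣d∣² = subst (ℕ._< 16) (sym (cong ∣_∣ N≡4)) (from-yes (4 ℕ.<? 16))
  ; generated-φ[u,v] = generated
  }
  where
  N≡4 : 1ℤ * 1ℤ + + 3 * (ε * ε) ≡ + 4
  N≡4 = cong (λ e → 1ℤ * 1ℤ + + 3 * e) ε²≡1
  re : + 4 * (m + ε * s) ≡ r * 1ℤ + + 3 * (s * ε)
  re = begin
    + 4 * (m + ε * s)                          ≡⟨ solve (m ∷ ε ∷ s ∷ []) ⟩
    (+ 4 * m + ε * s) * 1ℤ + + 3 * (s * ε)     ≡⟨ cong (λ z → z * 1ℤ + + 3 * (s * ε)) r≡4m+εs ⟨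
    r * 1ℤ + + 3 * (s * ε)                     ∎
  im : + 4 * (- (ε * m)) ≡ s * 1ℤ - r * ε
  im = begin
    + 4 * (- (ε * m))                          ≡⟨ solve (ε ∷ m ∷ s ∷ []) ⟩
    (ε * ε) * s - (+ 4 * m + ε * s) * ε        ≡⟨ cong₂ (λ e z → e * s - z * ε) ε²≡1 (sym r≡4m+εs) ⟩
    1ℤ * s - r * ε                             ≡⟨ cong (λ z → z - r * ε) (trans (ℤₚ.*-identityˡ s) (sym (ℤₚ.*-identityʳ s))) ⟩
    s * 1ℤ - r * ε                             ∎

-- [φ 1 (±1)] = [(-2, ±2, 4)] = [(1, ∓1, 2)], a generator since 1 + 3 = 2·2.
Generated-φ₃[1,1] : Generated (+ 3) (φ (+ 3) 1ℤ 1ℤ)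
Generated-φ₃[1,1] =
  Generated-resp (Equiv-trans (negate-Equiv -[1+ 1 ] (+ 2) (+ 4)) (scaleT-Equiv {+ 2} (1ℤ , -1ℤ , + 2) (λ ())))
  (Generated-gen ((refl , +<+ (s≤s z≤n)) , +<+ (s≤s z≤n) , 2 , refl , prime[2] , 1ℤ , 1ℤ , inj₂ refl))

Generated-φ₃[1,-1] : Generated (+ 3) (φ (+ 3) 1ℤ -1ℤ)
Generated-φ₃[1,-1] =
  Generated-resp (Equiv-trans (negate-Equiv -[1+ 1 ] -[1+ 1 ] (+ 4)) (scaleT-Equiv {+ 2} (1ℤ , 1ℤ , + 2) (λ ())))
  (Generated-gen ((refl , +<+ (s≤s z≤n)) , +<+ (s≤s z≤n) , 2 , refl , prime[2] , 1ℤ , 1ℤ , inj₂ refl))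

-- r and s are odd, so r - s or r + s is divisible by 4.
even-descends₃ : EvenNormDescends 3
even-descends₃ r s 2∣N 2∤s = inj₂ (by-parity (odd⇒≡2k+1 r 2∤r) (odd⇒≡2k+1 s 2∤s))
  where
  2∤r : ¬ (+ 2) ∣ℤ r
  2∤r 2∣r = 2∤s (prime-∣-square s prime[2] (prime-∣-*ʳ prime[2] 2∤3 (∣m+n∣m⇒∣n 2∣N (∣n⇒∣m*n r 2∣r))))
  by-parity : ∃[ a ] (r ≡ a * + 2 + 1ℤ) → ∃[ b ] (s ≡ b * + 2 + 1ℤ) → Descent (+ 3) r s
  by-parity (a , r≡2a+1) (b , s≡2b+1) = by-cases ((+ 2) ∣? (a - b))
    where
    r≡ : r ≡ ((a - b) + b) * + 2 + 1ℤ
    r≡ = trans r≡2a+1 (cong (λ z → z * + 2 + 1ℤ) (x≡x-y+y a b))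
    by-cases : Dec ((+ 2) ∣ℤ a - b) → Descent (+ 3) r s
    by-cases (yes (divides c a-b≡2c)) = descent₃ 1ℤ c refl r≡4c+s Generated-φ₃[1,1]
      where
      r≡4c+s : r ≡ + 4 * c + 1ℤ * s
      r≡4c+s = begin
        r                                   ≡⟨ r≡ ⟩
        ((a - b) + b) * + 2 + 1ℤ            ≡⟨ cong (λ z → (z + b) * + 2 + 1ℤ) a-b≡2c ⟩
        (c * + 2 + b) * + 2 + 1ℤ            ≡⟨ solve (c ∷ b ∷ []) ⟩
        + 4 * c + 1ℤ * (b * + 2 + 1ℤ)       ≡⟨ cong (λ z → + 4 * c + 1ℤ * z) s≡2b+1 ⟨
        + 4 * c + 1ℤ * s                    ∎
    by-cases (no 2∤a-b) with odd⇒≡2k+1 (a - b) 2∤a-b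
    ... | c , a-b≡2c+1 = descent₃ -1ℤ (c + b + 1ℤ) refl r≡4m-s Generated-φ₃[1,-1]
      where
      r≡4m-s : r ≡ + 4 * (c + b + 1ℤ) + -1ℤ * s
      r≡4m-s = begin
        r                                             ≡⟨ r≡ ⟩
        ((a - b) + b) * + 2 + 1ℤ                      ≡⟨ cong (λ z → (z + b) * + 2 + 1ℤ) a-b≡2c+1 ⟩
        ((c * + 2 + 1ℤ) + b) * + 2 + 1ℤ               ≡⟨ solve (c ∷ b ∷ []) ⟩
        + 4 * (c + b + 1ℤ) + -1ℤ * (b * + 2 + 1ℤ)     ≡⟨ cong (λ z → + 4 * (c + b + 1ℤ) + -1ℤ * z) s≡2b+1 ⟨
        + 4 * (c + b + 1ℤ) + -1ℤ * s                  ∎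

-- n = 2m with m ≥ 2 odd, so every prime factor of m is odd.
odd-prime-divisorᵤ : ∀ n → 3 ℕ.≤ n → 2 ℕ∣.∣ n → ¬ 4 ℕ∣.∣ n → ∃[ p ] (Prime p × 3 ℕ.≤ p × p ℕ∣.∣ n)
odd-prime-divisorᵤ n 3≤n (ℕ∣.divides m n≡2m) 4∤n = from-prime (prime-divisor m 2≤m)
  where
  2≤m : 2 ℕ.≤ m
  2≤m = ℕₚ.≰⇒> (λ m≤1 → ℕₚ.<⇒≱ 3≤n (subst (ℕ._≤ 2) (sym n≡2m) (ℕₚ.*-monoˡ-≤ 2 m≤1)))
  m∣n : m ℕ∣.∣ n
  m∣n = ℕ∣.divides 2 (trans n≡2m (ℕₚ.*-comm m 2))
  from-prime : ∃[ p ] (Prime p × p ℕ∣.∣ m) → ∃[ p ] (Prime p × 3 ℕ.≤ p × p ℕ∣.∣ n)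
  from-prime (p , p-prime , p∣m) with ℕₚ.m≤n⇒m<n∨m≡n (prime⇒2≤ p-prime)
  ... | inj₁ 3≤p = p , p-prime , 3≤p , ℕ∣.∣-trans p∣m m∣n
  ... | inj₂ refl = ⊥-elim (4∤n (ℕ∣.∣-trans (ℕ∣.*-monoʳ-∣ 2 p∣m) 2m∣n))
    where
    2m∣n : 2 ℕ.* m ℕ∣.∣ n
    2m∣n = ℕ∣.divides 1 (trans n≡2m (trans (ℕₚ.*-comm m 2) (sym (ℕₚ.*-identityˡ (2 ℕ.* m)))))

odd-prime-divisor : ∀ N K → N ≡ K * + 4 + + 6 → 3 ℕ.≤ ∣ N ∣ → OddPrimeDivisor N
odd-prime-divisor N K N≡4K+6 3≤∣N∣ with odd-prime-divisorᵤ ∣ N ∣ 3≤∣N∣ (∣⇒∣ᵤ 2∣N) (λ 4∣N → 4∤6 (4∣6 (∣ᵤ⇒∣ 4∣N)))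
  where
  2∣N : (+ 2) ∣ℤ N
  2∣N = divides (K * + 2 + + 3) (trans N≡4K+6 (solve (K ∷ [])))
  4∤6 : ¬ (+ 4) ∣ℤ + 6
  4∤6 = from-no ((+ 4) ∣? (+ 6))
  4∣6 : (+ 4) ∣ℤ N → (+ 4) ∣ℤ + 6
  4∣6 4∣N = ∣m+n∣m⇒∣n (subst ((+ 4) ∣ℤ_) N≡4K+6 4∣N) (divides K refl)
... | p , p-prime , 3≤p , p∣∣N∣ = p , p-prime , 3≤p , ∣ᵤ⇒∣ p∣∣N∣

odd⇒≢0 : ∀ {s} → ¬ (+ 2) ∣ℤ s → s ≢ 0ℤ
odd⇒≢0 2∤s refl = 2∤s (divides 0ℤ refl)

-- For odd r and s, r² + 5s² ≡ 6 (mod 8).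
even-descends₅ : EvenNormDescends 5
even-descends₅ r s 2∣N 2∤s = inj₁ (by-parity (odd⇒≡2k+1 r 2∤r) (odd⇒≡2k+1 s 2∤s))
  where
  2∤5 : ¬ (+ 2) ∣ℤ + 5
  2∤5 = from-no ((+ 2) ∣? (+ 5))
  2∤r : ¬ (+ 2) ∣ℤ r
  2∤r 2∣r = 2∤s (prime-∣-square s prime[2] (prime-∣-*ʳ prime[2] 2∤5 (∣m+n∣m⇒∣n 2∣N (∣n⇒∣m*n r 2∣r))))
  by-parity : ∃[ a ] (r ≡ a * + 2 + 1ℤ) → ∃[ b ] (s ≡ b * + 2 + 1ℤ) → OddPrimeDivisor (nrm (+ 5) r s)
  by-parity (a , r≡2a+1) (b , s≡2b+1) =
    odd-prime-divisor (nrm (+ 5) r s) (a * a + a + + 5 * (b * b) + + 5 * b) N≡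
      (ℕₚ.≤-trans (from-yes (3 ℕ.≤? 5)) (q₀≤∣nrm∣ 5 r s (odd⇒≢0 2∤s)))
    where
    N≡ : r * r + + 5 * (s * s) ≡ (a * a + a + + 5 * (b * b) + + 5 * b) * + 4 + + 6
    N≡ = begin
      r * r + + 5 * (s * s)
        ≡⟨ cong₂ (λ x y → x * x + + 5 * (y * y)) r≡2a+1 s≡2b+1 ⟩
      (a * + 2 + 1ℤ) * (a * + 2 + 1ℤ) + + 5 * ((b * + 2 + 1ℤ) * (b * + 2 + 1ℤ))
        ≡⟨ solve (a ∷ b ∷ []) ⟩
      (a * a + a + + 5 * (b * b) + + 5 * b) * + 4 + + 6
        ∎

-- For even r and odd s, r² + 6s² ≡ 6 (mod 8).
even-descends₆ : EvenNormDescends 6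
even-descends₆ r s 2∣N 2∤s = inj₁ (by-parity (prime-∣-square r prime[2] (∣m+n∣n⇒∣m 2∣N 2∣6s²)) (odd⇒≡2k+1 s 2∤s))
  where
  2∣6s² : (+ 2) ∣ℤ + 6 * (s * s)
  2∣6s² = divides (+ 3 * (s * s)) (solve (s ∷ []))
  by-parity : (+ 2) ∣ℤ r → ∃[ b ] (s ≡ b * + 2 + 1ℤ) → OddPrimeDivisor (nrm (+ 6) r s)
  by-parity (divides a r≡2a) (b , s≡2b+1) =
    odd-prime-divisor (nrm (+ 6) r s) (a * a + + 6 * (b * b) + + 6 * b) N≡
      (ℕₚ.≤-trans (from-yes (3 ℕ.≤? 6)) (q₀≤∣nrm∣ 6 r s (odd⇒≢0 2∤s)))
    where
    N≡ : r * r + + 6 * (s * s) ≡ (a * a + + 6 * (b * b) + + 6 * b) * + 4 + + 6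
    N≡ = begin
      r * r + + 6 * (s * s)
        ≡⟨ cong₂ (λ x y → x * x + + 6 * (y * y)) r≡2a s≡2b+1 ⟩
      (a * + 2) * (a * + 2) + + 6 * ((b * + 2 + 1ℤ) * (b * + 2 + 1ℤ))
        ≡⟨ solve (a ∷ b ∷ []) ⟩
      (a * a + + 6 * (b * b) + + 6 * b) * + 4 + + 6
        ∎

InT⇒Generated : ∀ q₀ → 2 ℕ.≤ q₀ → SmallMultiplesReduce q₀ → EvenNormDescends q₀ → ∀ t → InT (+ q₀) t → Generated (+ q₀) t
InT⇒Generated q₀ 2≤q₀ reduce even = InT⇒Generated-via-φ (+ q₀) q≢0
  (Generated-φ (+ q₀) (descent 2≤q₀ (represents-odd-prime-divisors (ℕₚ.≤-trans (s≤s z≤n) 2≤q₀) reduce) even))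
  where
  q≢0 : + q₀ ≢ 0ℤ
  q≢0 q≡0 = ℕₚ.<⇒≢ (ℕₚ.≤-trans (s≤s z≤n) 2≤q₀) (sym (ℤₚ.+-injective q≡0))

theorem2 : (q : ℤ) → (q ≡ + 2) ⊎ (q ≡ + 3) ⊎ (q ≡ + 5) ⊎ (q ≡ + 6) →
    (t : Triple) → InT q t → ∃[ s ] (InGenerated q s × Equiv t s)
theorem2 _ (inj₁ refl) = InT⇒Generated 2 (from-yes (2 ℕ.≤? 2)) multiples-reduce₂ even-descends₂
theorem2 _ (inj₂ (inj₁ refl)) = InT⇒Generated 3 (from-yes (2 ℕ.≤? 3)) multiples-reduce₃ even-descends₃
theorem2 _ (inj₂ (inj₂ (inj₁ refl))) = InT⇒Generated 5 (from-yes (2 ℕ.≤? 5)) multiples-reduce₅ even-descends₅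
theorem2 _ (inj₂ (inj₂ (inj₂ refl))) = InT⇒Generated 6 (from-yes (2 ℕ.≤? 6)) multiples-reduce₆ even-descends₆
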